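{- Let $n\ge 8$ be even, let $D$ be the distance matrix of the helm graph $H_n$ and $\mathcal{L}$ its special Laplacian. Let $v=(0,1,2,\dots,2,1)'\in\mathbb{R}^{n-1}$, $\widetilde{D}={\rm Circ}(v')$ and \[B = {\rm Circ}\Big(\frac{n-1}{2}v'-\frac{3}{2}\mathbf{1}'+\sum_{k=1}^{\frac{n}{2}-1}(-1)^{k}\frac{(n-1)-2k}{2}{c^k}'\widetilde{D}\Big).\] Then \[\mathcal{L} D = \begin{bmatrix} \frac{1-n}{2} & \frac{5-n}{2}\mathbf{1}' & \frac{5-n}{2}\mathbf{1}'\\ -\frac{1}{2}\mathbf{1}& B& 2I+B\\ \mathbf{1} & J &J-2I\end{bmatrix}.\]
   Context: For $n\ge 4$, the wheel graph $W_n$ has vertex set $\{1,\dots,n\}$: vertex $1$ is the center, adjacent to all others, and vertices $2,3,\dots,n$ form a cycle in this cyclic order. The helm graph $H_n$ on $m:=2n-1$ vertices is obtained from $W_n$ by adding vertices $n+1,\dots,m$ and the pendant edges $(j,n+j-1)$ for $2\le j\le n$. $D$ is the $m\times m$ shortest-path distance matrix of $H_n$, rows/columns indexed $1,\dots,m$. $\mathbf{1}$ is the all-ones vector in $\mathbb{R}^{n-1}$, $I$ and $J$ the $(n-1)\times(n-1)$ identity and all-ones matrices. The vector $v$ has first entry $0$, second and last entries $1$, and all other entries $2$. For $s=(s_1,\dots,s_\mu)'$, ${\rm Circ}(s')$ is the $\mu\times\mu$ circulant matrix whose first row is $s'$ and each subsequent row is the cyclic right shift of the previous one. For $k\in\{1,\dots,\frac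 n2-1\}$, $c^k\in\mathbb{R}^{n-1}$ has $c^k_j=1$ if $j=k+1$ or $j=n-k$, and $0$ otherwise, and $C_k:={\rm Circ}({c^k}')$. The special Laplacian is \[\mathcal{L} := \frac{1}{2}\begin{bmatrix} n-1 & -\mathbf{1}' & 0\\ -\mathbf{1}& (n+1) I & -2I\\ 0 & -2I & 2I\end{bmatrix}+\sum_{k=1}^{\frac{n}{2}-1}(-1)^{k}\frac{(n-1)-2k}{2}\begin{bmatrix} 0 & 0 & 0\\ 0& C_k & 0\\ 0 & 0 & 0\end{bmatrix},\] with blocks of sizes $1, n-1, n-1$ (the same block sizes as in the displayed $\mathcal L D$). -}

module Defs where

open import Data.Nat as ℕ using (ℕ; zero; suc; _∸_; _≤ᵇ_; _≡ᵇ_)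
import Data.Nat.DivMod as NDM
open import Data.Integer as ℤ using (ℤ; +_)
open import Data.Rational as ℚ using (ℚ; 0ℚ; 1ℚ; _+_; _*_; -_)
open import Data.Bool using (Bool; true; false; _∧_; _∨_; if_then_else_)
open import Data.Fin using (Fin; zero; suc; toℕ)

ℕ→ℚ : ℕ → ℚ
ℕ→ℚ k = + k ℚ./ 1

half : ℤ → ℚ
half z = z ℚ./ 2

sumℕ : ℕ → (ℕ → ℚ) → ℚ
sumℕ zero    f = 0ℚ
sumℕ (suc c) f = f 0 + sumℕ c (λ l → f (suc l))

sumFin : (k : ℕ) → (Fin k → ℚ) → ℚ
sumFin zero    f = 0ℚ
sumFin (suc k) f = f zero + sumFin k (λ l → f (suc l))

sign : ℕ → ℚ
sign zero    = 1ℚ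
sign (suc k) = - sign k

δ : ℕ → ℕ → ℚ
δ i j = if i ≡ᵇ j then 1ℚ else 0ℚ

Mat : ℕ → Set
Mat m = Fin m → Fin m → ℚ

_⊕_ : ∀ {m} → Mat m → Mat m → Mat m
(A ⊕ B) i j = A i j + B i j

_·_ : ∀ {m} → ℚ → Mat m → Mat m
(c · A) i j = c * A i j

mul : ∀ {m} → Mat m → Mat m → Mat m
mul {m} A B i j = sumFin m (λ l → A i l * B l j)

zeroMat : ∀ {m} → Mat m
zeroMat i j = 0ℚ

sumMat : ∀ {m} → ℕ → (ℕ → Mat m) → Mat m
sumMat zero    M = zeroMat
sumMat (suc c) M = M 0 ⊕ sumMat c (λ l → M (suc l))

helmSize : ℕ → ℕ
helmSize n = 2 ℕ.* n ∸ 1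

-- rim vertex of the wheel: 2 ≤ x ≤ n
rim : ℕ → ℕ → Bool
rim n x = (2 ≤ᵇ x) ∧ (x ≤ᵇ n)

-- one orientation of each edge of H_n
edge : ℕ → ℕ → ℕ → Bool
edge n i j =
     ((i ≡ᵇ 1) ∧ rim n j)                       -- spokes (1,j), 2 ≤ j ≤ n
  ∨ (rim n i ∧ rim n j ∧ (j ≡ᵇ suc i))         -- cycle edges (i,i+1)
  ∨ ((i ≡ᵇ n) ∧ (j ≡ᵇ 2))                       -- closing cycle edge (n,2)
  ∨ (rim n i ∧ (j ≡ᵇ n ℕ.+ i ∸ 1))              -- pendant edges (i,n+i-1)

adj : ℕ → ℕ → ℕ → Bool
adj n i j = edge n i j ∨ edge n j i

anyV : ℕ → (ℕ → Bool) → Bool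
anyV zero    p = false
anyV (suc c) p = p (suc c) ∨ anyV c p

reach : ℕ → ℕ → ℕ → ℕ → Bool
reach n zero    i j = i ≡ᵇ j
reach n (suc k) i j = reach n k i j ∨ anyV (helmSize n) (λ l → reach n k i l ∧ adj n l j)

distSearch : ℕ → ℕ → ℕ → ℕ → ℕ → ℕ
distSearch n i j k zero       = k
distSearch n i j k (suc fuel) = if reach n k i j then k else distSearch n i j (suc k) fuel

dist : ℕ → ℕ → ℕ → ℕ
dist n i j = distSearch n i j 0 (helmSize n)

-- distance matrix D of H_n; Fin index r corresponds to vertex r+1
DistHelm : (n : ℕ) → Mat (helmSize n)
DistHelm n i j = ℕ→ℚ (dist n (suc (toℕ i)) (suc (toℕ j)))

-- Block matrices with block sizes 1, n-1, n-1 (entries of a block are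
-- given 0-indexed by ℕ → ℕ → ℚ)

part : ℕ → ℕ → Fin 3
part n x = if x ≡ᵇ 0 then zero else (if x ≤ᵇ n ∸ 1 then suc zero else suc (suc zero))

local : ℕ → ℕ → ℕ
local n x = if x ≡ᵇ 0 then 0 else (if x ≤ᵇ n ∸ 1 then x ∸ 1 else x ∸ n)

block3 : (n : ℕ) → (Fin 3 → Fin 3 → ℕ → ℕ → ℚ) → Mat (helmSize n)
block3 n blk i j = blk (part n (toℕ i)) (part n (toℕ j)) (local n (toℕ i)) (local n (toℕ j))

-- Circulants, vectors (0-indexed, as ℕ → ℚ; only entries < μ matter)

Circ : ℕ → (ℕ → ℚ) → ℕ → ℕ → ℚ
Circ μ s i j = s (if i ≤ᵇ j then j ∸ i else μ ℕ.+ j ∸ i)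

vvec : ℕ → ℕ → ℚ
vvec n p = if p ≡ᵇ 0 then 0ℚ else (if (p ≡ᵇ 1) ∨ (p ≡ᵇ n ∸ 2) then 1ℚ else ℕ→ℚ 2)

-- c^k : entries at (1-indexed) positions k+1 and n-k equal 1
ck : ℕ → ℕ → ℕ → ℚ
ck n k p = if (p ≡ᵇ k) ∨ (p ≡ᵇ n ∸ 1 ∸ k) then 1ℚ else 0ℚ

Ck : ℕ → ℕ → ℕ → ℕ → ℚ
Ck n k = Circ (n ∸ 1) (ck n k)

Dtilde : ℕ → ℕ → ℕ → ℚ
Dtilde n = Circ (n ∸ 1) (vvec n)

coef : ℕ → ℕ → ℚ
coef n k = sign k * half (+ (n ∸ 1) ℤ.- + (2 ℕ.* k))

hm1 : ℕ → ℕ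
hm1 n = n NDM./ 2 ∸ 1

rowMul : ℕ → (ℕ → ℚ) → (ℕ → ℕ → ℚ) → ℕ → ℚ
rowMul μ c M j = sumℕ μ (λ i → c i * M i j)

brow : ℕ → ℕ → ℚ
brow n j = half (+ (n ∸ 1)) * vvec n j
         + (- half (+ 3))
         + sumℕ (hm1 n) (λ l → coef n (suc l) * rowMul (n ∸ 1) (ck n (suc l)) (Dtilde n) j)

Bmat : ℕ → ℕ → ℕ → ℚ
Bmat n = Circ (n ∸ 1) (brow n)

L0blocks : ℕ → Fin 3 → Fin 3 → ℕ → ℕ → ℚ
L0blocks n zero          zero          i j = ℕ→ℚ (n ∸ 1)
L0blocks n zero          (suc zero)    i j = - 1ℚ
L0blocks n (suc zero)    zero          i j = - 1ℚ
L0blocks n (suc zero)    (suc zero)    i j = ℕ→ℚ (suc n) * δ i j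
L0blocks n (suc zero)    (suc (suc zero)) i j = - (ℕ→ℚ 2 * δ i j)
L0blocks n (suc (suc zero)) (suc zero) i j = - (ℕ→ℚ 2 * δ i j)
L0blocks n (suc (suc zero)) (suc (suc zero)) i j = ℕ→ℚ 2 * δ i j
L0blocks n _             _             i j = 0ℚ

Ckblocks : ℕ → ℕ → Fin 3 → Fin 3 → ℕ → ℕ → ℚ
Ckblocks n k (suc zero) (suc zero) i j = Ck n k i j
Ckblocks n k _          _          i j = 0ℚ

LapHelm : (n : ℕ) → Mat (helmSize n)
LapHelm n = (½ · block3 n (L0blocks n))
          ⊕ sumMat (hm1 n) (λ l → coef n (suc l) · block3 n (Ckblocks n (suc l)))
  where open import Data.Rational using (½)

RHSblocks : ℕ → Fin 3 → Fin 3 → ℕ → ℕ → ℚ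
RHSblocks n zero          zero          i j = half (+ 1 ℤ.- + n)
RHSblocks n zero          (suc zero)    i j = half (+ 5 ℤ.- + n)
RHSblocks n zero          (suc (suc zero)) i j = half (+ 5 ℤ.- + n)
RHSblocks n (suc zero)    zero          i j = - half (+ 1)
RHSblocks n (suc zero)    (suc zero)    i j = Bmat n i j
RHSblocks n (suc zero)    (suc (suc zero)) i j = ℕ→ℚ 2 * δ i j + Bmat n i j
RHSblocks n (suc (suc zero)) zero       i j = 1ℚ
RHSblocks n (suc (suc zero)) (suc zero) i j = 1ℚ
RHSblocks n (suc (suc zero)) (suc (suc zero)) i j = 1ℚ + (- (ℕ→ℚ 2 * δ i j))

RHS : (n : ℕ) → Mat (helmSize n)
RHS n = block3 n (RHSblocks n)

{-# OPTIONS --safe #-}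
module Submission where

open import Defs
open import Data.Nat using (ℕ; _≤_)
open import Data.Nat.Divisibility using (_∣_)
open import Relation.Binary.PropositionalEquality using (_≡_)

open import Algebra.Bundles using (CommutativeMonoid)
open import Data.Bool using (Bool; true; false; T; _∧_; _∨_; if_then_else_)
open import Data.Bool.Properties using (T-∨; T-∧)
open import Data.Fin using (Fin; toℕ) renaming (zero to fzero; suc to fsuc)
open import Data.Fin.Properties using (toℕ<n)
open import Data.Integer as ℤ using (ℤ)
open import Data.Integer.Solver renaming (module +-*-Solver to ℤ-Solver)
open import Data.Nat as ℕ using (zero; suc; _∸_; _≤ᵇ_; _≡ᵇ_; z≤n; s≤s; _<_; NonZero)
open import Data.Nat.Divisibility using (divides)
open import Data.Nat.DivMod using (_%_; m<n⇒m%n≡m; [m+n]%n≡m%n; %-distribˡ-+; m%n%n≡m%n; m%n<n; m≤n⇒[n∸m]%m≡n%m; n%n≡0; m*n/n≡m)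
open import Data.Nat.Properties
open import Data.Product using (Σ; _×_; _,_; proj₁; proj₂)
open import Data.Rational as ℚ using (ℚ; 0ℚ; 1ℚ; _+_; _*_; -_; ½)
import Data.Rational.Properties as ℚP
open import Data.Rational.Solver using (module +-*-Solver)
import Data.Rational.Unnormalised as ℚᵘ
import Data.Rational.Unnormalised.Properties as ℚᵘP
open import Data.Sum using (_⊎_; inj₁; inj₂; map₂)
open import Data.Unit using (⊤; tt)
open import Function.Bundles using (Equivalence)
open import Relation.Binary.PropositionalEquality
open import Relation.Nullary using (¬_; yes; no; contradiction)
open import Relation.Nullary.Reflects using (Reflects; ofʸ; ofⁿ; fromEquivalence)

open import Algebra.Properties.CommutativeSemigroup (CommutativeMonoid.commutativeSemigroup ℚP.+-0-commutativeMonoid)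
  using () renaming (interchange to +-interchange)
open Equivalence using (to; from)

-- All distances in H_n are explicit. Two rim vertices at cyclic offset p are at distance v_p
-- (through the centre no two are further apart than 2), a pendant vertex adds 1 to the distance
-- of its rim neighbour, and the centre is at distance 1 from the rim and 2 from the pendants.
-- This formula is 1-Lipschitz along edges and every vertex has a neighbour one step closer to
-- any other, so it is the breadth-first distance. Hence every block of D is a circulant in
-- D̃ = Circ(v'), and ℒD is computed blockwise from three facts: each column of D̃ sums to
-- 2(n-1) - 4, the coefficients (-1)^k((n-1)-2k)/2 sum to -(n/2-1)/2, and circulants commute,
-- so that C_k D̃ = Circ(c^k' D̃).

module _ {p} {P : Set p} where

  reflects-true : ∀ {b} → Reflects P b → P → b ≡ true
  reflects-true (ofʸ _)  _ = refl
  reflects-true (ofⁿ ¬p) p = contradiction p ¬p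

  reflects-false : ∀ {b} → Reflects P b → ¬ P → b ≡ false
  reflects-false (ofʸ p) ¬p = contradiction p ¬p
  reflects-false (ofⁿ _) _  = refl

  reflects-⇔ : ∀ {q} {Q : Set q} {b c} → Reflects P b → Reflects Q c → (P → Q) → (Q → P) → b ≡ c
  reflects-⇔ (ofʸ _)  (ofʸ _)  _   _   = refl
  reflects-⇔ (ofʸ p)  (ofⁿ ¬q) p⇒q _   = contradiction (p⇒q p) ¬q
  reflects-⇔ (ofⁿ ¬p) (ofʸ q)  _   q⇒p = contradiction (q⇒p q) ¬p
  reflects-⇔ (ofⁿ _)  (ofⁿ _)  _   _   = refl

≡ᵇ-reflects : ∀ m n → Reflects (m ≡ n) (m ≡ᵇ n)
≡ᵇ-reflects m n = fromEquivalence (≡ᵇ⇒≡ m n) (≡⇒≡ᵇ m n)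

≡ᵇ-refl : ∀ m → (m ≡ᵇ m) ≡ true
≡ᵇ-refl m = reflects-true (≡ᵇ-reflects m m) refl

≤ᵇ-true : ∀ {m n} → m ≤ n → (m ≤ᵇ n) ≡ true
≤ᵇ-true {m} {n} = reflects-true (≤ᵇ-reflects-≤ m n)

≤ᵇ-false : ∀ {m n} → n < m → (m ≤ᵇ n) ≡ false
≤ᵇ-false {m} {n} n<m = reflects-false (≤ᵇ-reflects-≤ m n) (<⇒≱ n<m)

δ-⇔ : ∀ {i j u v} → (i ≡ j → u ≡ v) → (u ≡ v → i ≡ j) → δ i j ≡ δ u v
δ-⇔ {i} {j} {u} {v} i≡j⇒u≡v u≡v⇒i≡j =
  cong (if_then 1ℚ else 0ℚ) (reflects-⇔ (≡ᵇ-reflects i j) (≡ᵇ-reflects u v) i≡j⇒u≡v u≡v⇒i≡j)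

δ-comm : ∀ i j → δ i j ≡ δ j i
δ-comm i j = δ-⇔ {i} {j} sym sym

-- Cyclic offsets modulo N

module CyclicOffset (N : ℕ) .{{_ : NonZero N}} where

  -- (b - a) mod N, the index used by Circ: Circ N s a b = s (offset a b)
  offset : ℕ → ℕ → ℕ
  offset a b = if a ≤ᵇ b then b ∸ a else N ℕ.+ b ∸ a

  [m%N+o]%N≡[m+o]%N : ∀ m o → ((m % N) ℕ.+ o) % N ≡ (m ℕ.+ o) % N
  [m%N+o]%N≡[m+o]%N m o = begin
    ((m % N) ℕ.+ o) % N            ≡⟨ %-distribˡ-+ (m % N) o N ⟩
    ((m % N % N) ℕ.+ (o % N)) % N  ≡⟨ cong (λ z → (z ℕ.+ (o % N)) % N) (m%n%n≡m%n m N) ⟩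
    ((m % N) ℕ.+ (o % N)) % N      ≡⟨ %-distribˡ-+ m o N ⟨
    (m ℕ.+ o) % N                  ∎
    where open ≡-Reasoning

  [m+o%N]%N≡[m+o]%N : ∀ m o → (m ℕ.+ (o % N)) % N ≡ (m ℕ.+ o) % N
  [m+o%N]%N≡[m+o]%N m o = begin
    (m ℕ.+ (o % N)) % N ≡⟨ cong (_% N) (+-comm m (o % N)) ⟩
    ((o % N) ℕ.+ m) % N ≡⟨ [m%N+o]%N≡[m+o]%N o m ⟩
    (o ℕ.+ m) % N       ≡⟨ cong (_% N) (+-comm o m) ⟩
    (m ℕ.+ o) % N       ∎
    where open ≡-Reasoning

  [m+N]%N≡m : ∀ {m} → m < N → (m ℕ.+ N) % N ≡ m
  [m+N]%N≡m {m} m<N = trans ([m+n]%n≡m%n m N) (m<n⇒m%n≡m m<N)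

  offset-≤ : ∀ {a b} → a ≤ b → offset a b ≡ b ∸ a
  offset-≤ a≤b rewrite ≤ᵇ-true a≤b = refl

  offset-> : ∀ {a b} → b < a → offset a b ≡ N ℕ.+ b ∸ a
  offset-> b<a rewrite ≤ᵇ-false b<a = refl

  offset-self : ∀ a → offset a a ≡ 0
  offset-self a = trans (offset-≤ {a} ≤-refl) (n∸n≡0 a)

  offset<N : ∀ {a b} → a < N → b < N → offset a b < N
  offset<N {a} {b} a<N b<N with a ≤? b
  ... | yes a≤b = subst (_< N) (sym (offset-≤ a≤b)) (≤-<-trans (m∸n≤m b a) b<N)
  ... | no  a≰b = subst (_< N) (sym (offset-> (≰⇒> a≰b)))
                    (subst (N ℕ.+ b ∸ a <_) (m+n∸n≡m N a)
                      (∸-monoˡ-< (+-monoʳ-< N (≰⇒> a≰b)) (≤-trans (<⇒≤ a<N) (m≤m+n N b))))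

  +-offset : ∀ {a b} → a < N → b < N → (a ℕ.+ offset a b) % N ≡ b
  +-offset {a} {b} a<N b<N with a ≤? b
  ... | yes a≤b rewrite offset-≤ a≤b = trans (cong (_% N) (m+[n∸m]≡n a≤b)) (m<n⇒m%n≡m b<N)
  ... | no  a≰b rewrite offset-> (≰⇒> a≰b) = begin
    (a ℕ.+ (N ℕ.+ b ∸ a)) % N ≡⟨ cong (_% N) (m+[n∸m]≡n (≤-trans (<⇒≤ a<N) (m≤m+n N b))) ⟩
    (N ℕ.+ b) % N             ≡⟨ cong (_% N) (+-comm N b) ⟩
    (b ℕ.+ N) % N             ≡⟨ [m+N]%N≡m b<N ⟩
    b                         ∎
    where open ≡-Reasoning

  offset-+ : ∀ {a x} → a < N → x < N → offset a ((a ℕ.+ x) % N) ≡ x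
  offset-+ {a} {x} a<N x<N with a ℕ.+ x <? N
  ... | yes a+x<N rewrite m<n⇒m%n≡m a+x<N = trans (offset-≤ (m≤m+n a x)) (m+n∸m≡n a x)
  ... | no  a+x≮N = begin
    offset a ((a ℕ.+ x) % N)  ≡⟨ cong (offset a) wrap ⟩
    offset a (a ℕ.+ x ∸ N)    ≡⟨ offset-> a+x-N<a ⟩
    N ℕ.+ (a ℕ.+ x ∸ N) ∸ a   ≡⟨ cong (_∸ a) (m+[n∸m]≡n N≤a+x) ⟩
    a ℕ.+ x ∸ a               ≡⟨ m+n∸m≡n a x ⟩
    x                         ∎
    where
      open ≡-Reasoning
      N≤a+x : N ≤ a ℕ.+ x
      N≤a+x = ≮⇒≥ a+x≮N
      a+x-N<a : a ℕ.+ x ∸ N < a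
      a+x-N<a = subst (a ℕ.+ x ∸ N <_) (m+n∸n≡m a N) (∸-monoˡ-< (+-monoʳ-< a x<N) N≤a+x)
      wrap : (a ℕ.+ x) % N ≡ a ℕ.+ x ∸ N
      wrap = trans (sym (m≤n⇒[n∸m]%m≡n%m N≤a+x))
               (m<n⇒m%n≡m (subst (a ℕ.+ x ∸ N <_) (m+n∸n≡m N N) (∸-monoˡ-< (+-mono-< a<N x<N) N≤a+x)))

  offset-sound : ∀ {a b x} → a < N → b < N → offset a b ≡ x → (a ℕ.+ x) % N ≡ b
  offset-sound {a} a<N b<N refl = +-offset a<N b<N

  offset-unique : ∀ {a b x} → a < N → x < N → (a ℕ.+ x) % N ≡ b → offset a b ≡ x
  offset-unique a<N x<N refl = offset-+ a<N x<N

  offset≡0⇒≡ : ∀ {a b} → a < N → b < N → offset a b ≡ 0 → a ≡ b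
  offset≡0⇒≡ {a} a<N b<N e =
    trans (sym (m<n⇒m%n≡m a<N)) (trans (cong (_% N) (sym (+-identityʳ a))) (offset-sound a<N b<N e))

  rotate-back : ∀ {m o} → m < N → o ≤ N → ((m ℕ.+ o) % N ℕ.+ (N ∸ o)) % N ≡ m
  rotate-back {m} {o} m<N o≤N = begin
    ((m ℕ.+ o) % N ℕ.+ (N ∸ o)) % N ≡⟨ [m%N+o]%N≡[m+o]%N (m ℕ.+ o) (N ∸ o) ⟩
    (m ℕ.+ o ℕ.+ (N ∸ o)) % N       ≡⟨ cong (_% N) (+-assoc m o (N ∸ o)) ⟩
    (m ℕ.+ (o ℕ.+ (N ∸ o))) % N     ≡⟨ cong (λ z → (m ℕ.+ z) % N) (m+[n∸m]≡n o≤N) ⟩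
    (m ℕ.+ N) % N                   ≡⟨ [m+N]%N≡m m<N ⟩
    m                               ∎
    where open ≡-Reasoning

  offset≡⇒ : ∀ {a b x} → a < N → b < N → x ≤ N → offset a b ≡ x → a ≡ (b ℕ.+ (N ∸ x)) % N
  offset≡⇒ {a} {b} {x} a<N b<N x≤N e =
    sym (subst (λ y → (y ℕ.+ (N ∸ x)) % N ≡ a) (offset-sound a<N b<N e) (rotate-back a<N x≤N))

  offset≡⇐ : ∀ {a b x} → b < N → x < N → a ≡ (b ℕ.+ (N ∸ x)) % N → offset a b ≡ x
  offset≡⇐ {a} {b} {x} b<N x<N refl = offset-unique (m%n<n _ N) x<N
    (subst (λ y → ((b ℕ.+ (N ∸ x)) % N ℕ.+ y) % N ≡ b) (m∸[m∸n]≡n (<⇒≤ x<N)) (rotate-back b<N (m∸n≤m N x)))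

  offset-shift : ∀ {i c j} → i < N → c < N → j < N → offset ((i ℕ.+ c) % N) j ≡ offset c (offset i j)
  offset-shift {i} {c} {j} i<N c<N j<N = offset-unique (m%n<n _ N) (offset<N c<N d<N) (begin
    ((i ℕ.+ c) % N ℕ.+ y) % N ≡⟨ [m%N+o]%N≡[m+o]%N (i ℕ.+ c) y ⟩
    (i ℕ.+ c ℕ.+ y) % N       ≡⟨ cong (_% N) (+-assoc i c y) ⟩
    (i ℕ.+ (c ℕ.+ y)) % N     ≡⟨ [m+o%N]%N≡[m+o]%N i (c ℕ.+ y) ⟨
    (i ℕ.+ (c ℕ.+ y) % N) % N ≡⟨ cong (λ z → (i ℕ.+ z) % N) (+-offset c<N d<N) ⟩
    (i ℕ.+ offset i j) % N    ≡⟨ +-offset i<N j<N ⟩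
    j                         ∎)
    where
      open ≡-Reasoning
      d<N = offset<N i<N j<N
      y = offset c (offset i j)

  δ-offset : ∀ {a' a c} → a' < N → a < N → c < N → δ (offset a' a) c ≡ δ a ((a' ℕ.+ c) % N)
  δ-offset a'<N a<N c<N = δ-⇔ (λ e → sym (offset-sound a'<N a<N e)) (λ e → offset-unique a'<N c<N (sym e))

  δ-offset⁻ : ∀ {a b x} → a < N → b < N → x < N → δ (offset a b) x ≡ δ a ((b ℕ.+ (N ∸ x)) % N)
  δ-offset⁻ a<N b<N x<N = δ-⇔ (offset≡⇒ a<N b<N (<⇒≤ x<N)) (offset≡⇐ b<N x<N)

  offset-flip : ∀ {a b x} → a < N → b < N → 1 ≤ x → x < N → offset a b ≡ x → offset b a ≡ N ∸ x
  offset-flip {a} {b} a<N b<N 1≤x x<N e =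
    trans (cong (offset b) (offset≡⇒ a<N b<N (<⇒≤ x<N) e)) (offset-+ b<N (∸-monoʳ-< 1≤x (<⇒≤ x<N)))

  offset≡1 : ∀ {a b} → a < N → b < N → offset a b ≡ 1 → b ≡ suc a ⊎ (suc a ≡ N × b ≡ 0)
  offset≡1 {a} {b} a<N b<N e with suc a <? N | offset-sound a<N b<N e
  ... | yes 1+a<N | a+1%N≡b = inj₁ (trans (sym a+1%N≡b) (trans (cong (_% N) (+-comm a 1)) (m<n⇒m%n≡m 1+a<N)))
  ... | no  1+a≮N | a+1%N≡b =
    inj₂ (1+a≡N , trans (sym a+1%N≡b) (trans (cong (_% N) (trans (+-comm a 1) 1+a≡N)) (n%n≡0 N)))
    where
      1+a≡N : suc a ≡ N
      1+a≡N = ≤-antisym a<N (≮⇒≥ 1+a≮N)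

fromℚᵘ-+ : ∀ p q → ℚ.fromℚᵘ (p ℚᵘ.+ q) ≡ ℚ.fromℚᵘ p + ℚ.fromℚᵘ q
fromℚᵘ-+ p q = ℚP.toℚᵘ-injective (begin
  ℚ.toℚᵘ (ℚ.fromℚᵘ (p ℚᵘ.+ q))                     ≈⟨ ℚP.toℚᵘ-fromℚᵘ _ ⟩
  p ℚᵘ.+ q                                         ≈⟨ ℚᵘP.+-cong (ℚP.toℚᵘ-fromℚᵘ p) (ℚP.toℚᵘ-fromℚᵘ q) ⟨
  ℚ.toℚᵘ (ℚ.fromℚᵘ p) ℚᵘ.+ ℚ.toℚᵘ (ℚ.fromℚᵘ q)     ≈⟨ ℚP.toℚᵘ-homo-+ (ℚ.fromℚᵘ p) (ℚ.fromℚᵘ q) ⟨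
  ℚ.toℚᵘ (ℚ.fromℚᵘ p + ℚ.fromℚᵘ q)                 ∎)
  where open ℚᵘP.≃-Reasoning

fromℚᵘ-* : ∀ p q → ℚ.fromℚᵘ (p ℚᵘ.* q) ≡ ℚ.fromℚᵘ p * ℚ.fromℚᵘ q
fromℚᵘ-* p q = ℚP.toℚᵘ-injective (begin
  ℚ.toℚᵘ (ℚ.fromℚᵘ (p ℚᵘ.* q))                     ≈⟨ ℚP.toℚᵘ-fromℚᵘ _ ⟩
  p ℚᵘ.* q                                         ≈⟨ ℚᵘP.*-cong (ℚP.toℚᵘ-fromℚᵘ p) (ℚP.toℚᵘ-fromℚᵘ q) ⟨
  ℚ.toℚᵘ (ℚ.fromℚᵘ p) ℚᵘ.* ℚ.toℚᵘ (ℚ.fromℚᵘ q)     ≈⟨ ℚP.toℚᵘ-homo-* (ℚ.fromℚᵘ p) (ℚ.fromℚᵘ q) ⟨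
  ℚ.toℚᵘ (ℚ.fromℚᵘ p * ℚ.fromℚᵘ q)                 ∎)
  where open ℚᵘP.≃-Reasoning

ℤ→ℚ : ℤ → ℚ
ℤ→ℚ z = z ℚ./ 1

ℤ→ℚ-+ : ∀ a b → ℤ→ℚ (a ℤ.+ b) ≡ ℤ→ℚ a + ℤ→ℚ b
ℤ→ℚ-+ a b = trans (ℚP.fromℚᵘ-cong {ℚᵘ.mkℚᵘ (a ℤ.+ b) 0} {ℚᵘ.mkℚᵘ a 0 ℚᵘ.+ ℚᵘ.mkℚᵘ b 0} (ℚᵘ.*≡* cross)) (fromℚᵘ-+ (ℚᵘ.mkℚᵘ a 0) (ℚᵘ.mkℚᵘ b 0))
  where
    open ℤ-Solver
    cross : (a ℤ.+ b) ℤ.* ℤ.+ 1 ≡ (a ℤ.* ℤ.+ 1 ℤ.+ b ℤ.* ℤ.+ 1) ℤ.* ℤ.+ 1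
    cross = solve 2 (λ a b → (a :+ b) :* con (ℤ.+ 1) := (a :* con (ℤ.+ 1) :+ b :* con (ℤ.+ 1)) :* con (ℤ.+ 1)) refl a b

half≡½* : ∀ z → half z ≡ ½ * ℤ→ℚ z
half≡½* z = trans (ℚP.fromℚᵘ-cong {ℚᵘ.mkℚᵘ z 1} {ℚᵘ.mkℚᵘ (ℤ.+ 1) 1 ℚᵘ.* ℚᵘ.mkℚᵘ z 0} (ℚᵘ.*≡* cross)) (fromℚᵘ-* (ℚᵘ.mkℚᵘ (ℤ.+ 1) 1) (ℚᵘ.mkℚᵘ z 0))
  where
    open ℤ-Solver
    cross : z ℤ.* ℤ.+ 2 ≡ (ℤ.+ 1 ℤ.* z) ℤ.* ℤ.+ 2
    cross = solve 1 (λ z → z :* con (ℤ.+ 2) := (con (ℤ.+ 1) :* z) :* con (ℤ.+ 2)) refl z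

ℕ→ℚ-+ : ∀ a b → ℕ→ℚ (a ℕ.+ b) ≡ ℕ→ℚ a + ℕ→ℚ b
ℕ→ℚ-+ a b = ℤ→ℚ-+ (ℤ.+ a) (ℤ.+ b)

ℕ→ℚ-suc : ∀ a → ℕ→ℚ (suc a) ≡ 1ℚ + ℕ→ℚ a
ℕ→ℚ-suc = ℕ→ℚ-+ 1

half-ℕ-difference : ∀ a b → half (ℤ.+ a ℤ.- ℤ.+ b) ≡ ½ * (ℕ→ℚ a + - ℕ→ℚ b)
half-ℕ-difference a b = trans (half≡½* (ℤ.+ a ℤ.- ℤ.+ b)) (cong (½ *_) (trans (ℤ→ℚ-+ (ℤ.+ a) (ℤ.- ℤ.+ b)) (cong (λ w → ℕ→ℚ a + w) (neg b))))
  where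
    neg : ∀ b → ℤ→ℚ (ℤ.- ℤ.+ b) ≡ - ℕ→ℚ b
    neg zero    = refl
    neg (suc b) = refl

ℕ→ℚ-double : ∀ c → ℕ→ℚ (c ℕ.* 2) ≡ ℕ→ℚ c + ℕ→ℚ c
ℕ→ℚ-double c = trans (cong ℕ→ℚ (trans (*-comm c 2) (cong (c ℕ.+_) (+-identityʳ c)))) (ℕ→ℚ-+ c c)

sumℕ-cong : ∀ c {f g : ℕ → ℚ} → (∀ l → l < c → f l ≡ g l) → sumℕ c f ≡ sumℕ c g
sumℕ-cong zero    f≗g = refl
sumℕ-cong (suc c) f≗g = cong₂ _+_ (f≗g 0 (s≤s z≤n)) (sumℕ-cong c (λ l l<c → f≗g (suc l) (s≤s l<c)))

sumℕ-zero : ∀ c (f : ℕ → ℚ) → (∀ l → f l ≡ 0ℚ) → sumℕ c f ≡ 0ℚ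
sumℕ-zero zero    f f≗0 = refl
sumℕ-zero (suc c) f f≗0 rewrite f≗0 0 | sumℕ-zero c (λ l → f (suc l)) (λ l → f≗0 (suc l)) = refl

sumℕ-+ : ∀ c (f g : ℕ → ℚ) → sumℕ c (λ l → f l + g l) ≡ sumℕ c f + sumℕ c g
sumℕ-+ zero    f g = refl
sumℕ-+ (suc c) f g rewrite sumℕ-+ c (λ l → f (suc l)) (λ l → g (suc l)) = +-interchange (f 0) (g 0) _ _

sumℕ-*ˡ : ∀ c a (f : ℕ → ℚ) → sumℕ c (λ l → a * f l) ≡ a * sumℕ c f
sumℕ-*ˡ zero    a f = sym (ℚP.*-zeroʳ a)
sumℕ-*ˡ (suc c) a f rewrite sumℕ-*ˡ c a (λ l → f (suc l)) = sym (ℚP.*-distribˡ-+ a (f 0) _)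

sumℕ-*ʳ : ∀ c (f : ℕ → ℚ) a → sumℕ c (λ l → f l * a) ≡ sumℕ c f * a
sumℕ-*ʳ c f a = begin
  sumℕ c (λ l → f l * a) ≡⟨ sumℕ-cong c (λ l _ → ℚP.*-comm (f l) a) ⟩
  sumℕ c (λ l → a * f l) ≡⟨ sumℕ-*ˡ c a f ⟩
  a * sumℕ c f           ≡⟨ ℚP.*-comm a _ ⟩
  sumℕ c f * a           ∎
  where open ≡-Reasoning

sumℕ-neg : ∀ c (f : ℕ → ℚ) → sumℕ c (λ l → - f l) ≡ - sumℕ c f
sumℕ-neg zero    f = refl
sumℕ-neg (suc c) f rewrite sumℕ-neg c (λ l → f (suc l)) = sym (ℚP.neg-distrib-+ (f 0) _)

sumℕ-split : ∀ a b (f : ℕ → ℚ) → sumℕ (a ℕ.+ b) f ≡ sumℕ a f + sumℕ b (λ l → f (a ℕ.+ l))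
sumℕ-split zero    b f = sym (ℚP.+-identityˡ _)
sumℕ-split (suc a) b f rewrite sumℕ-split a b (λ l → f (suc l)) = sym (ℚP.+-assoc (f 0) _ _)

sumℕ-swap : ∀ c d (F : ℕ → ℕ → ℚ) → sumℕ c (λ l → sumℕ d (F l)) ≡ sumℕ d (λ k → sumℕ c (λ l → F l k))
sumℕ-swap zero    d F = sym (sumℕ-zero d (λ _ → 0ℚ) (λ _ → refl))
sumℕ-swap (suc c) d F rewrite sumℕ-swap c d (λ l → F (suc l)) =
  sym (sumℕ-+ d (F 0) (λ k → sumℕ c (λ l → F (suc l) k)))

sumℕ-δ : ∀ c a (f : ℕ → ℚ) → a < c → sumℕ c (λ l → δ l a * f l) ≡ f a
sumℕ-δ (suc c) zero f _ = begin
  1ℚ * f 0 + sumℕ c (λ l → 0ℚ * f (suc l)) ≡⟨ cong (λ w → 1ℚ * f 0 + w) (sumℕ-zero c _ (λ l → ℚP.*-zeroˡ (f (suc l)))) ⟩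
  1ℚ * f 0 + 0ℚ                             ≡⟨ ℚP.+-identityʳ _ ⟩
  1ℚ * f 0                                  ≡⟨ ℚP.*-identityˡ _ ⟩
  f 0                                       ∎
  where open ≡-Reasoning
sumℕ-δ (suc c) (suc a) f (s≤s a<c) =
  trans (cong (_+ sumℕ c (λ l → δ (suc l) (suc a) * f (suc l))) (ℚP.*-zeroˡ (f 0)))
        (trans (ℚP.+-identityˡ _) (sumℕ-δ c a (λ l → f (suc l)) a<c))

sumℕ-δ-scaled : ∀ c a x (f : ℕ → ℚ) → a < c → sumℕ c (λ l → x * δ a l * f l) ≡ x * f a
sumℕ-δ-scaled c a x f a<c = trans (sumℕ-cong c reorder) (sumℕ-δ c a (λ l → x * f l) a<c)
  where
    reorder : ∀ l → l < c → x * δ a l * f l ≡ δ l a * (x * f l)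
    reorder l _ = trans (cong (_* f l) (trans (ℚP.*-comm x (δ a l)) (cong (_* x) (δ-comm a l)))) (ℚP.*-assoc (δ l a) x (f l))

sumℕ-δ-one : ∀ c a → a < c → sumℕ c (λ l → δ l a) ≡ 1ℚ
sumℕ-δ-one c a a<c = trans (sumℕ-cong c (λ l _ → sym (ℚP.*-identityʳ (δ l a)))) (sumℕ-δ c a (λ _ → 1ℚ) a<c)

sumℕ-δ₂ : ∀ c u w (f : ℕ → ℚ) → u < c → w < c → sumℕ c (λ l → (δ l u + δ l w) * f l) ≡ f u + f w
sumℕ-δ₂ c u w f u<c w<c = begin
  sumℕ c (λ l → (δ l u + δ l w) * f l)           ≡⟨ sumℕ-cong c (λ l _ → ℚP.*-distribʳ-+ (f l) (δ l u) (δ l w)) ⟩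
  sumℕ c (λ l → δ l u * f l + δ l w * f l)       ≡⟨ sumℕ-+ c _ _ ⟩
  sumℕ c (λ l → δ l u * f l) + sumℕ c (λ l → δ l w * f l) ≡⟨ cong₂ _+_ (sumℕ-δ c u f u<c) (sumℕ-δ c w f w<c) ⟩
  f u + f w                                      ∎
  where open ≡-Reasoning

sumℕ-const : ∀ c x → sumℕ c (λ _ → x) ≡ ℕ→ℚ c * x
sumℕ-const zero    x = sym (ℚP.*-zeroˡ x)
sumℕ-const (suc c) x rewrite sumℕ-const c x | ℕ→ℚ-suc c = begin
  x + ℕ→ℚ c * x        ≡⟨ cong (_+ ℕ→ℚ c * x) (ℚP.*-identityˡ x) ⟨
  1ℚ * x + ℕ→ℚ c * x   ≡⟨ ℚP.*-distribʳ-+ x 1ℚ (ℕ→ℚ c) ⟨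
  (1ℚ + ℕ→ℚ c) * x     ∎
  where open ≡-Reasoning

sumFin≡sumℕ : ∀ k (f : Fin k → ℚ) (g : ℕ → ℚ) → (∀ l → f l ≡ g (toℕ l)) → sumFin k f ≡ sumℕ k g
sumFin≡sumℕ zero    f g f≗g = refl
sumFin≡sumℕ (suc k) f g f≗g = cong₂ _+_ (f≗g fzero) (sumFin≡sumℕ k (λ l → f (fsuc l)) (λ l → g (suc l)) (λ l → f≗g (fsuc l)))

sumMat-apply : ∀ {μ} c (M : ℕ → Mat μ) i j → sumMat c M i j ≡ sumℕ c (λ l → M l i j)
sumMat-apply zero    M i j = refl
sumMat-apply (suc c) M i j = cong (λ w → M 0 i j + w) (sumMat-apply c (λ l → M (suc l)) i j)

alternating : ℕ → ℚ → ℚ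
alternating c M = sumℕ c (λ l → sign (suc l) * (½ * (M + - ℕ→ℚ (2 ℕ.* suc l))))

alternating-suc : ∀ c M → alternating (suc c) M ≡ - (½ * (M + - ℕ→ℚ 2)) + - alternating c (M + - ℕ→ℚ 2)
alternating-suc c M = cong₂ _+_ (solve 1 (λ y → :- con 1ℚ :* y := :- y) refl (½ * (M + - ℕ→ℚ 2)))
  (trans (sumℕ-cong c (λ l _ → trans (cong (λ w → - sign (suc l) * (½ * (M + - w))) (ℕ→ℚ-two-more l))
      (solve 4 (λ s M x y → (:- s) :* (con ½ :* (M :+ :- (x :+ y))) := :- (s :* (con ½ :* ((M :+ :- x) :+ :- y)))) refl
         (sign (suc l)) M (ℕ→ℚ 2) (ℕ→ℚ (2 ℕ.* suc l)))))
    (sumℕ-neg c (λ l → sign (suc l) * (½ * ((M + - ℕ→ℚ 2) + - ℕ→ℚ (2 ℕ.* suc l))))))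
  where
    open +-*-Solver
    ℕ→ℚ-two-more : ∀ l → ℕ→ℚ (2 ℕ.* suc (suc l)) ≡ ℕ→ℚ 2 + ℕ→ℚ (2 ℕ.* suc l)
    ℕ→ℚ-two-more l = trans (cong ℕ→ℚ (*-suc 2 (suc l))) (ℕ→ℚ-+ 2 (2 ℕ.* suc l))

alternating-odd : ∀ c → alternating c (ℕ→ℚ (suc (c ℕ.* 2))) ≡ - (½ * ℕ→ℚ c)
alternating-odd zero    = refl
alternating-odd (suc c) = begin
  alternating (suc c) (ℕ→ℚ (2 ℕ.+ M))
    ≡⟨ alternating-suc c (ℕ→ℚ (2 ℕ.+ M)) ⟩
  - (½ * (ℕ→ℚ (2 ℕ.+ M) + - ℕ→ℚ 2)) + - alternating c (ℕ→ℚ (2 ℕ.+ M) + - ℕ→ℚ 2)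
    ≡⟨ cong (λ w → - (½ * w) + - alternating c w) drop-two ⟩
  - (½ * ℕ→ℚ M) + - alternating c (ℕ→ℚ M)
    ≡⟨ cong (λ w → - (½ * ℕ→ℚ M) + - w) (alternating-odd c) ⟩
  - (½ * ℕ→ℚ M) + - - (½ * ℕ→ℚ c)
    ≡⟨ cong (λ w → - (½ * w) + - - (½ * ℕ→ℚ c)) (trans (ℕ→ℚ-suc (c ℕ.* 2)) (cong (λ w → 1ℚ + w) (ℕ→ℚ-double c))) ⟩
  - (½ * (1ℚ + (ℕ→ℚ c + ℕ→ℚ c))) + - - (½ * ℕ→ℚ c)
    ≡⟨ solve 1 (λ x → :- (con ½ :* (con 1ℚ :+ (x :+ x))) :+ :- :- (con ½ :* x) := :- (con ½ :* (con 1ℚ :+ x))) refl (ℕ→ℚ c) ⟩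
  - (½ * (1ℚ + ℕ→ℚ c))
    ≡⟨ cong (λ w → - (½ * w)) (ℕ→ℚ-suc c) ⟨
  - (½ * ℕ→ℚ (suc c)) ∎
  where
    open ≡-Reasoning
    open +-*-Solver
    M = suc (c ℕ.* 2)
    drop-two : ℕ→ℚ (2 ℕ.+ M) + - ℕ→ℚ 2 ≡ ℕ→ℚ M
    drop-two = trans (cong (_+ - ℕ→ℚ 2) (ℕ→ℚ-+ 2 M)) (solve 2 (λ a b → (a :+ b) :+ :- a := b) refl (ℕ→ℚ 2) (ℕ→ℚ M))

anyV-intro : ∀ c (p : ℕ → Bool) l → 1 ≤ l → l ≤ c → T (p l) → T (anyV c p)
anyV-intro zero    p l 1≤l l≤0 _ = contradiction l≤0 (<⇒≱ 1≤l)
anyV-intro (suc c) p l 1≤l l≤1+c pl with l ℕ.≟ suc c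
... | yes refl   = from (T-∨ {p (suc c)}) (inj₁ pl)
... | no l≢1+c   = from (T-∨ {p (suc c)}) (inj₂ (anyV-intro c p l 1≤l (≤-pred (≤∧≢⇒< l≤1+c l≢1+c)) pl))

anyV-elim : ∀ c (p : ℕ → Bool) → T (anyV c p) → Σ ℕ λ l → 1 ≤ l × l ≤ c × T (p l)
anyV-elim (suc c) p t with to (T-∨ {p (suc c)}) t
... | inj₁ pc   = suc c , s≤s z≤n , ≤-refl , pc
... | inj₂ rest with anyV-elim c p rest
... | l , 1≤l , l≤c , pl = l , 1≤l , m≤n⇒m≤1+n l≤c , pl

distSearch-exact : ∀ n i j d → (∀ k → T (reach n k i j) → d ≤ k) → (∀ k → d ≤ k → T (reach n k i j)) →
                   ∀ fuel k → k ≤ d → d ≤ k ℕ.+ fuel → distSearch n i j k fuel ≡ d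
distSearch-exact n i j d sound complete zero k k≤d d≤k+0 = ≤-antisym k≤d (subst (d ≤_) (+-identityʳ k) d≤k+0)
distSearch-exact n i j d sound complete (suc fuel) k k≤d d≤k+1+fuel
  with reach n k i j in found
... | true  = ≤-antisym k≤d (sound k (subst T (sym found) tt))
... | false = distSearch-exact n i j d sound complete fuel (suc k)
                (≤∧≢⇒< k≤d (λ k≡d → subst T found (complete k (≤-reflexive (sym k≡d)))))
                (subst (d ≤_) (+-suc k fuel) d≤k+1+fuel)

-- Distances in the helm graph

-- n = 2(r + 2): the rim has N = n - 1 = 2t + 1 vertices, where t = n/2 - 1.
module HelmDistance (r : ℕ) where

  t : ℕ
  t = suc r

  N : ℕ
  N = suc (t ℕ.* 2)

  n : ℕ
  n = suc N

  m : ℕ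
  m = helmSize n

  m≡1+N+N : m ≡ suc (N ℕ.+ N)
  m≡1+N+N = trans (+-suc N (N ℕ.+ 0)) (cong (λ z → suc (N ℕ.+ z)) (+-identityʳ N))

  1<N : 1 < N
  1<N = s≤s (s≤s z≤n)

  open CyclicOffset N public

  cycleDist : ℕ → ℕ
  cycleDist p = if p ≡ᵇ 0 then 0 else (if (p ≡ᵇ 1) ∨ (p ≡ᵇ N ∸ 1) then 1 else 2)

  cycleDist-cases : ∀ p → (p ≡ 0 × cycleDist p ≡ 0) ⊎ ((p ≡ 1 ⊎ p ≡ N ∸ 1) × cycleDist p ≡ 1) ⊎ cycleDist p ≡ 2
  cycleDist-cases p with p ≡ᵇ 0 | ≡ᵇ-reflects p 0
  ... | true  | ofʸ p≡0 = inj₁ (p≡0 , refl)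
  ... | false | _ with p ≡ᵇ 1 | ≡ᵇ-reflects p 1
  ... | true  | ofʸ p≡1 = inj₂ (inj₁ (inj₁ p≡1 , refl))
  ... | false | _ with p ≡ᵇ N ∸ 1 | ≡ᵇ-reflects p (N ∸ 1)
  ... | true  | ofʸ p≡N-1 = inj₂ (inj₁ (inj₂ p≡N-1 , refl))
  ... | false | _         = inj₂ (inj₂ refl)

  cycleDist≤2 : ∀ p → cycleDist p ≤ 2
  cycleDist≤2 p with cycleDist-cases p
  ... | inj₁ (_ , d≡0)        rewrite d≡0 = z≤n
  ... | inj₂ (inj₁ (_ , d≡1)) rewrite d≡1 = s≤s z≤n
  ... | inj₂ (inj₂ d≡2)       rewrite d≡2 = ≤-refl

  cycleDist≡0⇒ : ∀ {p} → cycleDist p ≡ 0 → p ≡ 0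
  cycleDist≡0⇒ {p} d≡0 with cycleDist-cases p
  ... | inj₁ (p≡0 , _)        = p≡0
  ... | inj₂ (inj₁ (_ , d≡1)) = contradiction (trans (sym d≡1) d≡0) λ ()
  ... | inj₂ (inj₂ d≡2)       = contradiction (trans (sym d≡2) d≡0) λ ()

  cycleDist≡1⇒ : ∀ {p} → cycleDist p ≡ 1 → p ≡ 1 ⊎ p ≡ N ∸ 1
  cycleDist≡1⇒ {p} d≡1 with cycleDist-cases p
  ... | inj₁ (_ , d≡0)           = contradiction (trans (sym d≡0) d≡1) λ ()
  ... | inj₂ (inj₁ (p≡1⊎N-1 , _)) = p≡1⊎N-1
  ... | inj₂ (inj₂ d≡2)          = contradiction (trans (sym d≡2) d≡1) λ ()

  cycleDist-N∸1 : cycleDist (N ∸ 1) ≡ 1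
  cycleDist-N∸1 rewrite ≡ᵇ-refl (t ℕ.* 2) = refl

  rimDist : ℕ → ℕ → ℕ
  rimDist a b = cycleDist (offset a b)

  rimDist-self : ∀ a → rimDist a a ≡ 0
  rimDist-self a rewrite offset-self a = refl

  rimDist≡0⇒≡ : ∀ {a b} → a < N → b < N → rimDist a b ≡ 0 → a ≡ b
  rimDist≡0⇒≡ a<N b<N d≡0 = offset≡0⇒≡ a<N b<N (cycleDist≡0⇒ d≡0)

  data Vertex : Set where
    centre    : Vertex
    rimv leaf : ℕ → Vertex

  InRange : Vertex → Set
  InRange centre   = ⊤
  InRange (rimv a) = a < N
  InRange (leaf a) = a < N

  label : Vertex → ℕ
  label centre   = 1
  label (rimv a) = suc (suc a)
  label (leaf a) = suc (suc (N ℕ.+ a))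

  helmDist : Vertex → Vertex → ℕ
  helmDist centre   centre   = 0
  helmDist centre   (rimv _) = 1
  helmDist centre   (leaf _) = 2
  helmDist (rimv _) centre   = 1
  helmDist (rimv a) (rimv b) = rimDist a b
  helmDist (rimv a) (leaf b) = suc (rimDist a b)
  helmDist (leaf _) centre   = 2
  helmDist (leaf a) (rimv b) = suc (rimDist a b)
  helmDist (leaf a) (leaf b) = if a ≡ᵇ b then 0 else suc (suc (rimDist a b))

  data Edge : Vertex → Vertex → Set where
    spoke  : ∀ {b} → Edge centre (rimv b)
    spoke⁻ : ∀ {b} → Edge (rimv b) centre
    stem   : ∀ {b} → Edge (rimv b) (leaf b)
    stem⁻  : ∀ {b} → Edge (leaf b) (rimv b)
    arc    : ∀ {a b} → offset a b ≡ 1 → Edge (rimv a) (rimv b)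
    arc⁻   : ∀ {a b} → offset b a ≡ 1 → Edge (rimv a) (rimv b)

  Edge-sym : ∀ {Y Z} → Edge Y Z → Edge Z Y
  Edge-sym spoke   = spoke⁻
  Edge-sym spoke⁻  = spoke
  Edge-sym stem    = stem⁻
  Edge-sym stem⁻   = stem
  Edge-sym (arc e)  = arc⁻ e
  Edge-sym (arc⁻ e) = arc e

  arc⇒rimDist≡1 : ∀ {a b} → a < N → b < N → Edge (rimv a) (rimv b) → rimDist a b ≡ 1
  arc⇒rimDist≡1 _ _ (arc e) rewrite e = refl
  arc⇒rimDist≡1 a<N b<N (arc⁻ e) rewrite offset-flip b<N a<N (s≤s z≤n) 1<N e = cycleDist-N∸1

  rimDist≡1⇒arc : ∀ {a b} → a < N → b < N → rimDist a b ≡ 1 → Edge (rimv a) (rimv b)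
  rimDist≡1⇒arc a<N b<N d≡1 with cycleDist≡1⇒ d≡1
  ... | inj₁ ab≡1   = arc ab≡1
  ... | inj₂ ab≡N-1 = arc⁻ (trans (offset-flip a<N b<N (s≤s z≤n) (s≤s ≤-refl) ab≡N-1) (m∸[m∸n]≡n (<⇒≤ 1<N)))

  rimDist-step : ∀ {x b b'} → x < N → b < N → rimDist b b' ≡ 1 → rimDist x b' ≤ suc (rimDist x b)
  rimDist-step {x} {b} {b'} x<N b<N bb'≡1 with rimDist x b ℕ.≟ 0
  ... | yes xb≡0 rewrite rimDist≡0⇒≡ x<N b<N xb≡0 | bb'≡1 | rimDist-self b = ≤-refl
  ... | no  xb≢0 = ≤-trans (cycleDist≤2 (offset x b')) (s≤s (n≢0⇒n>0 xb≢0))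

  helmDist-edge : ∀ X {Y Z} → InRange X → InRange Y → InRange Z → Edge Y Z → helmDist X Z ≤ suc (helmDist X Y)
  helmDist-edge centre _ _ _ spoke    = ≤-refl
  helmDist-edge centre _ _ _ spoke⁻   = z≤n
  helmDist-edge centre _ _ _ stem     = ≤-refl
  helmDist-edge centre _ _ _ stem⁻    = s≤s z≤n
  helmDist-edge centre _ _ _ (arc _)  = s≤s z≤n
  helmDist-edge centre _ _ _ (arc⁻ _) = s≤s z≤n
  helmDist-edge (rimv x) _ _ _ (spoke {b}) = cycleDist≤2 (offset x b)
  helmDist-edge (rimv x) _ _ _ spoke⁻      = s≤s z≤n
  helmDist-edge (rimv x) _ _ _ stem        = ≤-refl
  helmDist-edge (rimv x) _ _ _ stem⁻       = m≤n⇒m≤1+n (n≤1+n _)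
  helmDist-edge (rimv x) x<N y<N z<N e@(arc _)  = rimDist-step x<N y<N (arc⇒rimDist≡1 y<N z<N e)
  helmDist-edge (rimv x) x<N y<N z<N e@(arc⁻ _) = rimDist-step x<N y<N (arc⇒rimDist≡1 y<N z<N e)
  helmDist-edge (leaf x) _ _ _ (spoke {b}) = s≤s (cycleDist≤2 (offset x b))
  helmDist-edge (leaf x) _ _ _ spoke⁻      = s≤s (s≤s z≤n)
  helmDist-edge (leaf x) _ _ _ (stem {b}) with x ≡ᵇ b
  ... | true  = z≤n
  ... | false = ≤-refl
  helmDist-edge (leaf x) _ _ _ (stem⁻ {b}) with x ≡ᵇ b | ≡ᵇ-reflects x b
  ... | true  | ofʸ refl = s≤s (≤-reflexive (rimDist-self x))
  ... | false | _        = s≤s (m≤n⇒m≤1+n (n≤1+n _))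
  helmDist-edge (leaf x) x<N y<N z<N e@(arc _)  = s≤s (rimDist-step x<N y<N (arc⇒rimDist≡1 y<N z<N e))
  helmDist-edge (leaf x) x<N y<N z<N e@(arc⁻ _) = s≤s (rimDist-step x<N y<N (arc⇒rimDist≡1 y<N z<N e))

  helmDist-self : ∀ X → helmDist X X ≡ 0
  helmDist-self centre   = refl
  helmDist-self (rimv a) = rimDist-self a
  helmDist-self (leaf a) rewrite ≡ᵇ-refl a = refl

  helmDist≡0⇒≡ : ∀ X Y → InRange X → InRange Y → helmDist X Y ≡ 0 → X ≡ Y
  helmDist≡0⇒≡ centre   centre   _   _   _ = refl
  helmDist≡0⇒≡ (rimv a) (rimv b) a<N b<N d≡0 = cong rimv (rimDist≡0⇒≡ a<N b<N d≡0)
  helmDist≡0⇒≡ (leaf a) (leaf b) _   _   d≡0 with a ≡ᵇ b | ≡ᵇ-reflects a b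
  ... | true | ofʸ a≡b = cong leaf a≡b
  helmDist≡0⇒≡ centre   (rimv _) _ _ ()
  helmDist≡0⇒≡ centre   (leaf _) _ _ ()
  helmDist≡0⇒≡ (rimv _) centre   _ _ ()
  helmDist≡0⇒≡ (rimv _) (leaf _) _ _ ()
  helmDist≡0⇒≡ (leaf _) centre   _ _ ()
  helmDist≡0⇒≡ (leaf _) (rimv _) _ _ ()

  helmDist≤4 : ∀ X Y → helmDist X Y ≤ 4
  helmDist≤4 centre   centre   = z≤n
  helmDist≤4 centre   (rimv _) = s≤s z≤n
  helmDist≤4 centre   (leaf _) = s≤s (s≤s z≤n)
  helmDist≤4 (rimv _) centre   = s≤s z≤n
  helmDist≤4 (rimv a) (rimv b) = m≤n⇒m≤o+n 2 (cycleDist≤2 (offset a b))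
  helmDist≤4 (rimv a) (leaf b) = s≤s (m≤n⇒m≤1+n (cycleDist≤2 (offset a b)))
  helmDist≤4 (leaf _) centre   = s≤s (s≤s z≤n)
  helmDist≤4 (leaf a) (rimv b) = s≤s (m≤n⇒m≤1+n (cycleDist≤2 (offset a b)))
  helmDist≤4 (leaf a) (leaf b) with a ≡ᵇ b
  ... | true  = z≤n
  ... | false = s≤s (s≤s (cycleDist≤2 (offset a b)))

  closer-neighbour : ∀ X Y → InRange X → InRange Y → 1 ≤ helmDist X Y →
                     Σ Vertex λ Z → InRange Z × Edge Z Y × suc (helmDist X Z) ≤ helmDist X Y
  closer-neighbour centre   (rimv b) _   _   _ = centre , tt , spoke , ≤-refl
  closer-neighbour centre   (leaf b) _   b<N _ = rimv b , b<N , stem , ≤-refl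
  closer-neighbour (rimv a) centre   a<N _   _ = rimv a , a<N , spoke⁻ , s≤s (≤-reflexive (rimDist-self a))
  closer-neighbour (rimv a) (rimv b) a<N b<N d≥1 with cycleDist-cases (offset a b)
  ... | inj₁ (_ , d≡0)        = contradiction (subst (1 ≤_) d≡0 d≥1) λ ()
  ... | inj₂ (inj₁ (_ , d≡1)) = rimv a , a<N , rimDist≡1⇒arc a<N b<N d≡1 ,
                                  subst (suc (rimDist a a) ≤_) (sym d≡1) (s≤s (≤-reflexive (rimDist-self a)))
  ... | inj₂ (inj₂ d≡2)       = centre , tt , spoke , ≤-reflexive (sym d≡2)
  closer-neighbour (rimv a) (leaf b) _   b<N _ = rimv b , b<N , stem , ≤-refl
  closer-neighbour (leaf a) centre   a<N _   _ = rimv a , a<N , spoke⁻ , s≤s (s≤s (≤-reflexive (rimDist-self a)))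
  closer-neighbour (leaf a) (rimv b) a<N b<N d≥1 with cycleDist-cases (offset a b)
  ... | inj₁ (ab≡0 , _) rewrite offset≡0⇒≡ a<N b<N ab≡0 =
          leaf b , b<N , stem⁻ , s≤s (≤-reflexive (trans (helmDist-self (leaf b)) (sym (rimDist-self b))))
  ... | inj₂ (inj₁ (_ , d≡1)) = rimv a , a<N , rimDist≡1⇒arc a<N b<N d≡1 ,
                                  s≤s (subst (suc (rimDist a a) ≤_) (sym d≡1) (s≤s (≤-reflexive (rimDist-self a))))
  ... | inj₂ (inj₂ d≡2)       = centre , tt , spoke , s≤s (≤-reflexive (sym d≡2))
  closer-neighbour (leaf a) (leaf b) _   b<N d≥1 with a ≡ᵇ b
  ... | false = rimv b , b<N , stem , ≤-refl

  label≡1⇒centre : ∀ Z → label Z ≡ 1 → Z ≡ centre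
  label≡1⇒centre centre _ = refl

  label-injective : ∀ X Y → InRange X → InRange Y → label X ≡ label Y → X ≡ Y
  label-injective centre   centre   _   _   _ = refl
  label-injective (rimv a) (rimv b) _   _   refl = refl
  label-injective (leaf a) (leaf b) _   _   e = cong leaf (+-cancelˡ-≡ N a b (suc-injective (suc-injective e)))
  label-injective (rimv a) (leaf b) a<N _   e = contradiction (subst (N ≤_) (sym (suc-injective (suc-injective e))) (m≤m+n N b)) (<⇒≱ a<N)
  label-injective (leaf a) (rimv b) _   b<N e = contradiction (subst (N ≤_) (suc-injective (suc-injective e)) (m≤m+n N a)) (<⇒≱ b<N)

  label-bounds : ∀ Z → InRange Z → 1 ≤ label Z × label Z ≤ m
  label-bounds centre   _   = s≤s z≤n , subst (1 ≤_) (sym m≡1+N+N) (s≤s z≤n)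
  label-bounds (rimv a) a<N = s≤s z≤n , subst (label (rimv a) ≤_) (sym m≡1+N+N) (s≤s (≤-trans a<N (m≤m+n N N)))
  label-bounds (leaf a) a<N = s≤s z≤n , subst (label (leaf a) ≤_) (sym m≡1+N+N)
                                          (s≤s (subst (_≤ N ℕ.+ N) (+-suc N a) (+-monoʳ-≤ N a<N)))

  label-surjective : ∀ l → 1 ≤ l → l ≤ m → Σ Vertex λ X → InRange X × l ≡ label X
  label-surjective (suc zero)    _ _ = centre , tt , refl
  label-surjective (suc (suc y)) _ l≤m with y <? N
  ... | yes y<N = rimv y , y<N , refl
  ... | no  y≮N = leaf (y ∸ N) , y-N<N , cong (λ z → suc (suc z)) (sym (m+[n∸m]≡n N≤y))
    where
      N≤y = ≮⇒≥ y≮N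
      y-N<N : y ∸ N < N
      y-N<N = subst (y ∸ N <_) (m+n∸n≡m N N) (∸-monoˡ-< (≤-pred (subst (suc (suc y) ≤_) m≡1+N+N l≤m)) N≤y)

  rim-label : ∀ Y → T (rim n (label Y)) → Σ ℕ λ b → Y ≡ rimv b
  rim-label (rimv b) _ = b , refl
  rim-label (leaf a) e = contradiction (≤ᵇ⇒≤ (label (leaf a)) n e) (<⇒≱ (s≤s (s≤s (m≤m+n N a))))

  rim-rimv : ∀ {a} → a < N → T (rim n (label (rimv a)))
  rim-rimv a<N = ≤⇒≤ᵇ (s≤s a<N)

  pendantLabel : ∀ a → n ℕ.+ label (rimv a) ∸ 1 ≡ label (leaf a)
  pendantLabel a = trans (+-suc N (suc a)) (cong suc (+-suc N a))

  offset-succ : ∀ a → offset a (suc a) ≡ 1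
  offset-succ a = trans (offset-≤ (n≤1+n a)) (trans (cong (_∸ a) (+-comm 1 a)) (m+n∸m≡n a 1))

  offset-wrap : offset (N ∸ 1) 0 ≡ 1
  offset-wrap = trans (offset-> {N ∸ 1} {0} (s≤s z≤n)) (trans (cong (_∸ (N ∸ 1)) (+-identityʳ N)) (m∸[m∸n]≡n (<⇒≤ 1<N)))

  module _ (i j : ℕ) where

    spokeTest arcTest wrapTest stemTest : Bool
    spokeTest = (i ≡ᵇ 1) ∧ rim n j
    arcTest   = rim n i ∧ rim n j ∧ (j ≡ᵇ suc i)
    wrapTest  = (i ≡ᵇ n) ∧ (j ≡ᵇ 2)
    stemTest  = rim n i ∧ (j ≡ᵇ n ℕ.+ i ∸ 1)

    edge-cases : T (edge n i j) → T spokeTest ⊎ T arcTest ⊎ T wrapTest ⊎ T stemTest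
    edge-cases e with to (T-∨ {spokeTest}) e
    ... | inj₁ s = inj₁ s
    ... | inj₂ e′ with to (T-∨ {arcTest}) e′
    ... | inj₁ a = inj₂ (inj₁ a)
    ... | inj₂ e″ = inj₂ (inj₂ (to (T-∨ {wrapTest}) e″))

    edge-intro : T spokeTest ⊎ T arcTest ⊎ T wrapTest ⊎ T stemTest → T (edge n i j)
    edge-intro c = from (T-∨ {spokeTest}) (map₂ (λ c′ → from (T-∨ {arcTest}) (map₂ (from (T-∨ {wrapTest})) c′)) c)

    adj-forward : T (edge n i j) → T (adj n i j)
    adj-forward e = from (T-∨ {edge n i j}) (inj₁ e)

    adj-backward : T (edge n j i) → T (adj n i j)
    adj-backward e = from (T-∨ {edge n i j}) (inj₂ e)

  edge⇒Edge : ∀ Z Y → InRange Z → InRange Y → T (edge n (label Z) (label Y)) → Edge Z Y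
  edge⇒Edge Z Y z y e with edge-cases (label Z) (label Y) e
  ... | inj₁ s with to (T-∧ {label Z ≡ᵇ 1}) s
  ...   | isCentre , rimY with label≡1⇒centre Z (≡ᵇ⇒≡ (label Z) 1 isCentre) | rim-label Y rimY
  ...     | refl | _ , refl = spoke
  edge⇒Edge Z Y z y e | inj₂ (inj₁ a) with to (T-∧ {rim n (label Z)}) a
  ... | rimZ , rest with to (T-∧ {rim n (label Y)}) rest
  ...   | rimY , succ with rim-label Z rimZ | rim-label Y rimY
  ...     | a , refl | b , refl with ≡ᵇ⇒≡ (label (rimv b)) (suc (label (rimv a))) succ
  ...       | refl = arc (offset-succ a)
  edge⇒Edge Z Y z y e | inj₂ (inj₂ (inj₁ w)) with to (T-∧ {label Z ≡ᵇ n}) w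
  ... | isLast , isFirst
      with label-injective Z (rimv (N ∸ 1)) z ≤-refl (≡ᵇ⇒≡ (label Z) n isLast)
         | label-injective Y (rimv 0) y (s≤s z≤n) (≡ᵇ⇒≡ (label Y) 2 isFirst)
  ...   | refl | refl = arc offset-wrap
  edge⇒Edge Z Y z y e | inj₂ (inj₂ (inj₂ s)) with to (T-∧ {rim n (label Z)}) s
  ... | rimZ , isStem with rim-label Z rimZ
  ...   | a , refl with label-injective Y (leaf a) y z (trans (≡ᵇ⇒≡ (label Y) _ isStem) (pendantLabel a))
  ...     | refl = stem

  adj⇒Edge : ∀ Z Y → InRange Z → InRange Y → T (adj n (label Z) (label Y)) → Edge Z Y
  adj⇒Edge Z Y z y e with to (T-∨ {edge n (label Z) (label Y)}) e
  ... | inj₁ e₁ = edge⇒Edge Z Y z y e₁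
  ... | inj₂ e₂ = Edge-sym (edge⇒Edge Y Z y z e₂)

  spoke-edge : ∀ {b} → b < N → T (edge n 1 (label (rimv b)))
  spoke-edge {b} b<N = edge-intro 1 (label (rimv b)) (inj₁ (rim-rimv b<N))

  stem-edge : ∀ {b} → b < N → T (edge n (label (rimv b)) (label (leaf b)))
  stem-edge {b} b<N = edge-intro (label (rimv b)) (label (leaf b))
    (inj₂ (inj₂ (inj₂ (from (T-∧ {rim n (label (rimv b))}) (rim-rimv b<N , ≡⇒≡ᵇ _ _ (sym (pendantLabel b)))))))

  arc-edge : ∀ {a b} → a < N → b < N → offset a b ≡ 1 → T (edge n (label (rimv a)) (label (rimv b)))
  arc-edge {a} {b} a<N b<N e with offset≡1 a<N b<N e
  ... | inj₁ refl = edge-intro (label (rimv a)) (label (rimv b)) (inj₂ (inj₁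
        (from (T-∧ {rim n (label (rimv a))}) (rim-rimv a<N ,
          from (T-∧ {rim n (label (rimv b))}) (rim-rimv b<N , ≡⇒≡ᵇ (label (rimv b)) _ refl)))))
  ... | inj₂ (1+a≡N , refl) = edge-intro (label (rimv a)) (label (rimv b)) (inj₂ (inj₂ (inj₁
        (from (T-∧ {label (rimv a) ≡ᵇ n}) (≡⇒≡ᵇ _ _ (cong suc 1+a≡N) , tt)))))

  Edge⇒adj : ∀ Z Y → InRange Z → InRange Y → Edge Z Y → T (adj n (label Z) (label Y))
  Edge⇒adj Z Y _   b<N spoke    = adj-forward  (label Z) (label Y) (spoke-edge b<N)
  Edge⇒adj Z Y b<N _   spoke⁻   = adj-backward (label Z) (label Y) (spoke-edge b<N)
  Edge⇒adj Z Y b<N _   stem     = adj-forward  (label Z) (label Y) (stem-edge b<N)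
  Edge⇒adj Z Y _   b<N stem⁻    = adj-backward (label Z) (label Y) (stem-edge b<N)
  Edge⇒adj Z Y a<N b<N (arc e)  = adj-forward  (label Z) (label Y) (arc-edge a<N b<N e)
  Edge⇒adj Z Y a<N b<N (arc⁻ e) = adj-backward (label Z) (label Y) (arc-edge b<N a<N e)

  reach-sound : ∀ k X Y → InRange X → InRange Y → T (reach n k (label X) (label Y)) → helmDist X Y ≤ k
  reach-sound zero X Y x y e with label-injective X Y x y (≡ᵇ⇒≡ (label X) (label Y) e)
  ... | refl = ≤-reflexive (helmDist-self X)
  reach-sound (suc k) X Y x y e with to (T-∨ {reach n k (label X) (label Y)}) e
  ... | inj₁ e₁ = m≤n⇒m≤1+n (reach-sound k X Y x y e₁)
  ... | inj₂ e₂ with anyV-elim m (λ l → reach n k (label X) l ∧ adj n l (label Y)) e₂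
  ...   | l , 1≤l , l≤m , viaL with label-surjective l 1≤l l≤m
  ...     | Z , z , refl with to (T-∧ {reach n k (label X) (label Z)}) viaL
  ...       | reachZ , adjZY =
    ≤-trans (helmDist-edge X x z y (adj⇒Edge Z Y z y adjZY)) (s≤s (reach-sound k X Z x z reachZ))

  reach-complete : ∀ k X Y → InRange X → InRange Y → helmDist X Y ≤ k → T (reach n k (label X) (label Y))
  reach-complete zero X Y x y d≤0 with helmDist≡0⇒≡ X Y x y (n≤0⇒n≡0 d≤0)
  ... | refl = ≡⇒≡ᵇ (label X) (label X) refl
  reach-complete (suc k) X Y x y d≤1+k with helmDist X Y ≤? k
  ... | yes d≤k = from (T-∨ {reach n k (label X) (label Y)}) (inj₁ (reach-complete k X Y x y d≤k))
  ... | no  d≰k with closer-neighbour X Y x y (≤-trans (s≤s z≤n) (≰⇒> d≰k))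
  ...   | Z , z , edgeZY , closer = from (T-∨ {reach n k (label X) (label Y)}) (inj₂
          (anyV-intro m (λ l → reach n k (label X) l ∧ adj n l (label Y)) (label Z)
            (proj₁ (label-bounds Z z)) (proj₂ (label-bounds Z z))
            (from (T-∧ {reach n k (label X) (label Z)})
              (reach-complete k X Z x z (≤-pred (≤-trans closer d≤1+k)) , Edge⇒adj Z Y z y edgeZY))))

  dist-label : ∀ X Y → InRange X → InRange Y → dist n (label X) (label Y) ≡ helmDist X Y
  dist-label X Y x y = distSearch-exact n (label X) (label Y) (helmDist X Y)
    (λ k → reach-sound k X Y x y) (λ k → reach-complete k X Y x y) m 0 z≤n
    (≤-trans (helmDist≤4 X Y) (subst (4 ≤_) (sym m≡1+N+N) (s≤s (≤-trans (s≤s (s≤s (s≤s z≤n))) (m≤m+n N N)))))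

-- The product ℒD

module HelmProduct (r : ℕ) where
  open HelmDistance r

  index : Vertex → ℕ
  index centre   = 0
  index (rimv a) = suc a
  index (leaf a) = suc (N ℕ.+ a)

  kind : Vertex → Fin 3
  kind centre   = fzero
  kind (rimv _) = fsuc fzero
  kind (leaf _) = fsuc (fsuc fzero)

  pos : Vertex → ℕ
  pos centre   = 0
  pos (rimv a) = a
  pos (leaf a) = a

  part-index : ∀ X → InRange X → part n (index X) ≡ kind X
  part-index centre   _   = refl
  part-index (rimv a) a<N rewrite ≤ᵇ-true a<N = refl
  part-index (leaf a) _   rewrite ≤ᵇ-false {suc (N ℕ.+ a)} {N} (s≤s (m≤m+n N a)) = refl

  local-index : ∀ X → InRange X → local n (index X) ≡ pos X
  local-index centre   _   = refl
  local-index (rimv a) a<N rewrite ≤ᵇ-true a<N = refl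
  local-index (leaf a) _   rewrite ≤ᵇ-false {suc (N ℕ.+ a)} {N} (s≤s (m≤m+n N a)) = m+n∸m≡n N a

  suc-index : ∀ X → suc (index X) ≡ label X
  suc-index centre   = refl
  suc-index (rimv _) = refl
  suc-index (leaf _) = refl

  index-surjective : ∀ x → x < m → Σ Vertex λ X → InRange X × x ≡ index X
  index-surjective x x<m with label-surjective (suc x) (s≤s z≤n) x<m
  ... | centre   , _   , refl = centre   , tt  , refl
  ... | rimv a   , a<N , refl = rimv a   , a<N , refl
  ... | leaf a   , a<N , refl = leaf a   , a<N , refl

  onBlocks : (Fin 3 → Fin 3 → ℕ → ℕ → ℚ) → ℕ → ℕ → ℚ
  onBlocks blk x y = blk (part n x) (part n y) (local n x) (local n y)

  onBlocks-index : ∀ blk X Y → InRange X → InRange Y → onBlocks blk (index X) (index Y) ≡ blk (kind X) (kind Y) (pos X) (pos Y)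
  onBlocks-index blk X Y x y rewrite part-index X x | part-index Y y | local-index X x | local-index Y y = refl

  lapBlocks : Fin 3 → Fin 3 → ℕ → ℕ → ℚ
  lapBlocks P Q i j = ½ * L0blocks n P Q i j + sumℕ (hm1 n) (λ k → coef n (suc k) * Ckblocks n (suc k) P Q i j)

  lap : Vertex → Vertex → ℚ
  lap X Z = lapBlocks (kind X) (kind Z) (pos X) (pos Z)

  vertexSum : (Vertex → ℚ) → ℚ
  vertexSum g = g centre + (sumℕ N (λ a → g (rimv a)) + sumℕ N (λ a → g (leaf a)))

  column : Vertex → Vertex → ℚ
  column Y Z = ℕ→ℚ (helmDist Z Y)

  vertexSum-cong : ∀ {f g} → (∀ Z → InRange Z → f Z ≡ g Z) → vertexSum f ≡ vertexSum g
  vertexSum-cong f≗g = cong₂ _+_ (f≗g centre tt)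
    (cong₂ _+_ (sumℕ-cong N (λ a a<N → f≗g (rimv a) a<N)) (sumℕ-cong N (λ a a<N → f≗g (leaf a) a<N)))

  sumℕ-m : ∀ (F : ℕ → ℚ) → sumℕ m F ≡ vertexSum (λ Z → F (index Z))
  sumℕ-m F = trans (cong (λ c → sumℕ c F) m≡1+N+N) (cong (λ w → F 0 + w) (sumℕ-split N N (λ a → F (suc a))))

  ℒD-entry : ∀ X Y → InRange X → InRange Y → (i j : Fin m) → toℕ i ≡ index X → toℕ j ≡ index Y →
             mul (LapHelm n) (DistHelm n) i j ≡ vertexSum (λ Z → lap X Z * column Y Z)
  ℒD-entry X Y x y i j i≡X j≡Y = begin
    mul (LapHelm n) (DistHelm n) i j
      ≡⟨ sumFin≡sumℕ m _ (λ l → onBlocks lapBlocks (toℕ i) l * ℕ→ℚ (dist n (suc l) (suc (toℕ j))))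
           (λ l → cong (λ w → (½ * onBlocks (L0blocks n) (toℕ i) (toℕ l) + w) * DistHelm n l j)
                    (sumMat-apply (hm1 n) (λ k → coef n (suc k) · block3 n (Ckblocks n (suc k))) i l)) ⟩
    sumℕ m (λ l → onBlocks lapBlocks (toℕ i) l * ℕ→ℚ (dist n (suc l) (suc (toℕ j))))
      ≡⟨ sumℕ-m (λ l → onBlocks lapBlocks (toℕ i) l * ℕ→ℚ (dist n (suc l) (suc (toℕ j)))) ⟩
    vertexSum (λ Z → onBlocks lapBlocks (toℕ i) (index Z) * ℕ→ℚ (dist n (suc (index Z)) (suc (toℕ j))))
      ≡⟨ vertexSum-cong (λ Z z → cong₂ _*_
           (trans (cong (λ x → onBlocks lapBlocks x (index Z)) i≡X) (onBlocks-index lapBlocks X Z x z))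
           (cong ℕ→ℚ (begin
             dist n (suc (index Z)) (suc (toℕ j)) ≡⟨ cong₂ (dist n) (suc-index Z) (trans (cong suc j≡Y) (suc-index Y)) ⟩
             dist n (label Z) (label Y)          ≡⟨ dist-label Z Y z y ⟩
             helmDist Z Y                        ∎))) ⟩
    vertexSum (λ Z → lap X Z * column Y Z) ∎
    where open ≡-Reasoning

  circulant-free : ∀ x → x + sumℕ (hm1 n) (λ k → coef n (suc k) * 0ℚ) ≡ x
  circulant-free x = trans (cong (x +_) (sumℕ-zero (hm1 n) _ (λ k → ℚP.*-zeroʳ (coef n (suc k))))) (ℚP.+-identityʳ x)

  lap-centre-centre : lap centre centre ≡ ½ * ℕ→ℚ N
  lap-centre-centre = circulant-free _

  lap-centre-rim : ∀ a → lap centre (rimv a) ≡ - ½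
  lap-centre-rim a = circulant-free _

  lap-centre-leaf : ∀ a → lap centre (leaf a) ≡ 0ℚ
  lap-centre-leaf a = circulant-free _

  lap-rim-centre : ∀ a' → lap (rimv a') centre ≡ - ½
  lap-rim-centre a' = circulant-free _

  lap-rim-rim : ∀ a' a → lap (rimv a') (rimv a) ≡
                ½ * ℕ→ℚ (suc n) * δ a' a + sumℕ (hm1 n) (λ k → coef n (suc k) * Ck n (suc k) a' a)
  lap-rim-rim a' a = cong (_+ sumℕ (hm1 n) (λ k → coef n (suc k) * Ck n (suc k) a' a))
                       (sym (ℚP.*-assoc ½ (ℕ→ℚ (suc n)) (δ a' a)))

  ½*-2x : ∀ x → ½ * - (ℕ→ℚ 2 * x) ≡ - 1ℚ * x
  ½*-2x = solve 1 (λ x → con ½ :* :- (con (ℕ→ℚ 2) :* x) := :- con 1ℚ :* x) refl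
    where open +-*-Solver

  lap-rim-leaf : ∀ a' a → lap (rimv a') (leaf a) ≡ - 1ℚ * δ a' a
  lap-rim-leaf a' a = trans (circulant-free _) (½*-2x (δ a' a))

  lap-leaf-centre : ∀ a' → lap (leaf a') centre ≡ 0ℚ
  lap-leaf-centre a' = circulant-free _

  lap-leaf-rim : ∀ a' a → lap (leaf a') (rimv a) ≡ - 1ℚ * δ a' a
  lap-leaf-rim a' a = trans (circulant-free _) (½*-2x (δ a' a))

  lap-leaf-leaf : ∀ a' a → lap (leaf a') (leaf a) ≡ 1ℚ * δ a' a
  lap-leaf-leaf a' a = trans (circulant-free _) (solve 1 (λ x → con ½ :* (con (ℕ→ℚ 2) :* x) := con 1ℚ :* x) refl (δ a' a))
    where open +-*-Solver

  h≡t : hm1 n ≡ t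
  h≡t = cong (_∸ 1) (m*n/n≡m (suc t) 2)

  shift-bounds : ∀ {c} → 1 ≤ c → c ≤ t → c < N × N ∸ c < N × ¬ (c ≡ N ∸ c)
  shift-bounds {c} 1≤c c≤t = c<N , ∸-monoʳ-< 1≤c (<⇒≤ c<N) , c≢N∸c
    where
      c<N : c < N
      c<N = s≤s (≤-trans c≤t (m≤m*n t 2))
      c≢N∸c : ¬ (c ≡ N ∸ c)
      c≢N∸c c≡N∸c = 1+n≰n (subst (_≤ t ℕ.* 2) (trans (cong (c ℕ.+_) c≡N∸c) (m+[n∸m]≡n (<⇒≤ c<N)))
                      (subst (c ℕ.+ c ≤_) (trans (cong (t ℕ.+_) (sym (+-identityʳ t))) (*-comm 2 t)) (+-mono-≤ c≤t c≤t)))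

  ck-split : ∀ c → ¬ (c ≡ N ∸ c) → ∀ p → ck n c p ≡ δ p c + δ p (N ∸ c)
  ck-split c c≢N∸c p with p ≡ᵇ c | ≡ᵇ-reflects p c | p ≡ᵇ N ∸ c | ≡ᵇ-reflects p (N ∸ c)
  ... | true  | ofʸ refl | true  | ofʸ p≡N∸c = contradiction p≡N∸c c≢N∸c
  ... | true  | _        | false | _         = refl
  ... | false | _        | true  | _         = refl
  ... | false | _        | false | _         = refl

  Ck-sum : ∀ c a' (f : ℕ → ℚ) → 1 ≤ c → c ≤ t → a' < N →
           sumℕ N (λ a → Ck n c a' a * f a) ≡ f ((a' ℕ.+ c) % N) + f ((a' ℕ.+ (N ∸ c)) % N)
  Ck-sum c a' f 1≤c c≤t a'<N with shift-bounds 1≤c c≤t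
  ... | c<N , N∸c<N , c≢N∸c = trans
    (sumℕ-cong N (λ a a<N → cong (_* f a) (trans (ck-split c c≢N∸c (offset a' a))
      (cong₂ _+_ (δ-offset a'<N a<N c<N) (δ-offset a'<N a<N N∸c<N)))))
    (sumℕ-δ₂ N ((a' ℕ.+ c) % N) ((a' ℕ.+ (N ∸ c)) % N) f (m%n<n (a' ℕ.+ c) N) (m%n<n (a' ℕ.+ (N ∸ c)) N))

  circulantPart : ℕ → (ℕ → ℚ) → ℚ
  circulantPart a' f = sumℕ (hm1 n) (λ k → coef n (suc k) * (f ((a' ℕ.+ suc k) % N) + f ((a' ℕ.+ (N ∸ suc k)) % N)))

  circulant-row : ∀ a' (f : ℕ → ℚ) → a' < N →
    sumℕ N (λ a → sumℕ (hm1 n) (λ k → coef n (suc k) * Ck n (suc k) a' a) * f a) ≡ circulantPart a' f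
  circulant-row a' f a'<N = begin
    sumℕ N (λ a → sumℕ h (λ k → coef n (suc k) * Ck n (suc k) a' a) * f a)
      ≡⟨ sumℕ-cong N (λ a _ → trans (sym (sumℕ-*ʳ h (λ k → coef n (suc k) * Ck n (suc k) a' a) (f a)))
           (sumℕ-cong h (λ k _ → ℚP.*-assoc (coef n (suc k)) (Ck n (suc k) a' a) (f a)))) ⟩
    sumℕ N (λ a → sumℕ h (λ k → coef n (suc k) * (Ck n (suc k) a' a * f a)))
      ≡⟨ sumℕ-swap N h (λ a k → coef n (suc k) * (Ck n (suc k) a' a * f a)) ⟩
    sumℕ h (λ k → sumℕ N (λ a → coef n (suc k) * (Ck n (suc k) a' a * f a)))
      ≡⟨ sumℕ-cong h (λ k k<h → trans (sumℕ-*ˡ N (coef n (suc k)) (λ a → Ck n (suc k) a' a * f a))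
           (cong (coef n (suc k) *_) (Ck-sum (suc k) a' f (s≤s z≤n) (subst (suc k ≤_) h≡t k<h) a'<N))) ⟩
    circulantPart a' f ∎
    where
      open ≡-Reasoning
      h = hm1 n

  row-centre : ∀ (g : Vertex → ℚ) → vertexSum (λ Z → lap centre Z * g Z) ≡ ½ * ℕ→ℚ N * g centre + - ½ * sumℕ N (λ a → g (rimv a))
  row-centre g = begin
    vertexSum (λ Z → lap centre Z * g Z)
      ≡⟨ cong₂ _+_ (cong (_* g centre) lap-centre-centre)
           (cong₂ _+_ (sumℕ-cong N (λ a _ → cong (_* g (rimv a)) (lap-centre-rim a)))
                      (sumℕ-zero N (λ a → lap centre (leaf a) * g (leaf a)) (λ a → trans (cong (_* g (leaf a)) (lap-centre-leaf a)) (ℚP.*-zeroˡ (g (leaf a)))))) ⟩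
    ½ * ℕ→ℚ N * g centre + (sumℕ N (λ a → - ½ * g (rimv a)) + 0ℚ)
      ≡⟨ cong (½ * ℕ→ℚ N * g centre +_) (trans (ℚP.+-identityʳ _) (sumℕ-*ˡ N (- ½) (λ a → g (rimv a)))) ⟩
    ½ * ℕ→ℚ N * g centre + - ½ * sumℕ N (λ a → g (rimv a)) ∎
    where open ≡-Reasoning

  row-rim : ∀ a' (g : Vertex → ℚ) → a' < N → vertexSum (λ Z → lap (rimv a') Z * g Z) ≡
            - ½ * g centre + ½ * ℕ→ℚ (suc n) * g (rimv a') + circulantPart a' (λ a → g (rimv a)) + - 1ℚ * g (leaf a')
  row-rim a' g a'<N = begin
    vertexSum (λ Z → lap (rimv a') Z * g Z)
      ≡⟨ cong₂ _+_ (cong (_* g centre) (lap-rim-centre a')) (cong₂ _+_ rimPart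
           (trans (sumℕ-cong N (λ a _ → cong (_* g (leaf a)) (lap-rim-leaf a' a)))
                  (sumℕ-δ-scaled N a' (- 1ℚ) (λ a → g (leaf a)) a'<N))) ⟩
    - ½ * g centre + ((½ * ℕ→ℚ (suc n) * g (rimv a') + circulantPart a' (λ a → g (rimv a))) + - 1ℚ * g (leaf a'))
      ≡⟨ solve 4 (λ c r k l → con (- ½) :* c :+ ((r :+ k) :+ l) := con (- ½) :* c :+ r :+ k :+ l) refl
           (g centre) (½ * ℕ→ℚ (suc n) * g (rimv a')) (circulantPart a' (λ a → g (rimv a))) (- 1ℚ * g (leaf a')) ⟩
    - ½ * g centre + ½ * ℕ→ℚ (suc n) * g (rimv a') + circulantPart a' (λ a → g (rimv a)) + - 1ℚ * g (leaf a') ∎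
    where
      open ≡-Reasoning
      open +-*-Solver
      C : ℕ → ℚ
      C a = sumℕ (hm1 n) (λ k → coef n (suc k) * Ck n (suc k) a' a)
      rimPart : sumℕ N (λ a → lap (rimv a') (rimv a) * g (rimv a)) ≡
                ½ * ℕ→ℚ (suc n) * g (rimv a') + circulantPart a' (λ a → g (rimv a))
      rimPart = begin
        sumℕ N (λ a → lap (rimv a') (rimv a) * g (rimv a))
          ≡⟨ sumℕ-cong N (λ a _ → trans (cong (_* g (rimv a)) (lap-rim-rim a' a))
               (ℚP.*-distribʳ-+ (g (rimv a)) (½ * ℕ→ℚ (suc n) * δ a' a) (C a))) ⟩
        sumℕ N (λ a → ½ * ℕ→ℚ (suc n) * δ a' a * g (rimv a) + C a * g (rimv a))
          ≡⟨ sumℕ-+ N (λ a → ½ * ℕ→ℚ (suc n) * δ a' a * g (rimv a)) (λ a → C a * g (rimv a)) ⟩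
        sumℕ N (λ a → ½ * ℕ→ℚ (suc n) * δ a' a * g (rimv a)) + sumℕ N (λ a → C a * g (rimv a))
          ≡⟨ cong₂ _+_ (sumℕ-δ-scaled N a' (½ * ℕ→ℚ (suc n)) (λ a → g (rimv a)) a'<N)
                       (circulant-row a' (λ a → g (rimv a)) a'<N) ⟩
        ½ * ℕ→ℚ (suc n) * g (rimv a') + circulantPart a' (λ a → g (rimv a)) ∎

  row-leaf : ∀ a' (g : Vertex → ℚ) → a' < N → vertexSum (λ Z → lap (leaf a') Z * g Z) ≡ - 1ℚ * g (rimv a') + g (leaf a')
  row-leaf a' g a'<N = begin
    vertexSum (λ Z → lap (leaf a') Z * g Z)
      ≡⟨ cong₂ _+_ (trans (cong (_* g centre) (lap-leaf-centre a')) (ℚP.*-zeroˡ (g centre))) (cong₂ _+_ rimPart leafPart) ⟩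
    0ℚ + (- 1ℚ * g (rimv a') + g (leaf a')) ≡⟨ ℚP.+-identityˡ _ ⟩
    - 1ℚ * g (rimv a') + g (leaf a') ∎
    where
      open ≡-Reasoning
      rimPart : sumℕ N (λ a → lap (leaf a') (rimv a) * g (rimv a)) ≡ - 1ℚ * g (rimv a')
      rimPart = trans (sumℕ-cong N (λ a _ → cong (_* g (rimv a)) (lap-leaf-rim a' a)))
                      (sumℕ-δ-scaled N a' (- 1ℚ) (λ a → g (rimv a)) a'<N)
      leafPart : sumℕ N (λ a → lap (leaf a') (leaf a) * g (leaf a)) ≡ g (leaf a')
      leafPart = trans (sumℕ-cong N (λ a _ → cong (_* g (leaf a)) (lap-leaf-leaf a' a)))
                       (trans (sumℕ-δ-scaled N a' 1ℚ (λ a → g (leaf a)) a'<N) (ℚP.*-identityˡ (g (leaf a'))))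

  coef-sum : sumℕ (hm1 n) (λ k → coef n (suc k)) ≡ - (½ * ℕ→ℚ t)
  coef-sum = begin
    sumℕ (hm1 n) (λ k → coef n (suc k)) ≡⟨ cong (λ c → sumℕ c (λ k → coef n (suc k))) h≡t ⟩
    sumℕ t (λ k → coef n (suc k))       ≡⟨ sumℕ-cong t (λ k _ → cong (sign (suc k) *_) (half-ℕ-difference N (2 ℕ.* suc k))) ⟩
    alternating t (ℕ→ℚ N)               ≡⟨ alternating-odd t ⟩
    - (½ * ℕ→ℚ t)                       ∎
    where open ≡-Reasoning

  circulantPart-const : ∀ a' x → circulantPart a' (λ _ → x) ≡ - (ℕ→ℚ t * x)
  circulantPart-const a' x = begin
    sumℕ (hm1 n) (λ k → coef n (suc k) * (x + x)) ≡⟨ sumℕ-*ʳ (hm1 n) (λ k → coef n (suc k)) (x + x) ⟩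
    sumℕ (hm1 n) (λ k → coef n (suc k)) * (x + x) ≡⟨ cong (_* (x + x)) coef-sum ⟩
    - (½ * ℕ→ℚ t) * (x + x)                       ≡⟨ solve 2 (λ t x → :- (con ½ :* t) :* (x :+ x) := :- (t :* x)) refl (ℕ→ℚ t) x ⟩
    - (ℕ→ℚ t * x)                                 ∎
    where
      open ≡-Reasoning
      open +-*-Solver

  circulantPart-+ : ∀ a' (f g : ℕ → ℚ) → circulantPart a' (λ a → f a + g a) ≡ circulantPart a' f + circulantPart a' g
  circulantPart-+ a' f g = trans
    (sumℕ-cong (hm1 n) (λ k _ → solve 5 (λ c x y u v → c :* ((x :+ u) :+ (y :+ v)) := c :* (x :+ y) :+ c :* (u :+ v)) refl
      (coef n (suc k)) (f ((a' ℕ.+ suc k) % N)) (f ((a' ℕ.+ (N ∸ suc k)) % N)) (g ((a' ℕ.+ suc k) % N)) (g ((a' ℕ.+ (N ∸ suc k)) % N))))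
    (sumℕ-+ (hm1 n) (λ k → coef n (suc k) * (f ((a' ℕ.+ suc k) % N) + f ((a' ℕ.+ (N ∸ suc k)) % N)))
                    (λ k → coef n (suc k) * (g ((a' ℕ.+ suc k) % N) + g ((a' ℕ.+ (N ∸ suc k)) % N))))
    where open +-*-Solver

  rowMul-ck : ∀ c d → 1 ≤ c → c ≤ t → rowMul (n ∸ 1) (ck n c) (Dtilde n) d ≡ Dtilde n c d + Dtilde n (N ∸ c) d
  rowMul-ck c d 1≤c c≤t with shift-bounds 1≤c c≤t
  ... | c<N , N∸c<N , c≢N∸c = trans (sumℕ-cong N (λ i _ → cong (_* Dtilde n i d) (ck-split c c≢N∸c i)))
                                    (sumℕ-δ₂ N c (N ∸ c) (λ i → Dtilde n i d) c<N N∸c<N)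

  circulantSum : ℕ → ℚ
  circulantSum p = sumℕ (hm1 n) (λ l → coef n (suc l) * rowMul (n ∸ 1) (ck n (suc l)) (Dtilde n) p)

  -- Circulants commute: C_k D̃ = Circ(c^k' D̃).
  circulantPart-Dtilde : ∀ a' b → a' < N → b < N → circulantPart a' (λ a → Dtilde n a b) ≡ circulantSum (offset a' b)
  circulantPart-Dtilde a' b a'<N b<N = sumℕ-cong (hm1 n) λ k k<h → cong (coef n (suc k) *_) (shifted (suc k) (s≤s z≤n) (subst (suc k ≤_) h≡t k<h))
    where
      shifted : ∀ c → 1 ≤ c → c ≤ t →
                Dtilde n ((a' ℕ.+ c) % N) b + Dtilde n ((a' ℕ.+ (N ∸ c)) % N) b ≡ rowMul (n ∸ 1) (ck n c) (Dtilde n) (offset a' b)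
      shifted c 1≤c c≤t with shift-bounds 1≤c c≤t
      ... | c<N , N∸c<N , _ = trans (cong₂ _+_ (cong (vvec n) (offset-shift a'<N c<N b<N)) (cong (vvec n) (offset-shift a'<N N∸c<N b<N)))
                                    (sym (rowMul-ck c (offset a' b) 1≤c c≤t))

  ℕ→ℚ-cycleDist : ∀ p → ℕ→ℚ (cycleDist p) ≡ vvec n p
  ℕ→ℚ-cycleDist p with p ≡ᵇ 0 | (p ≡ᵇ 1) ∨ (p ≡ᵇ N ∸ 1)
  ... | true  | _     = refl
  ... | false | true  = refl
  ... | false | false = refl

  vvec-spikes : ∀ p → vvec n p ≡ ℕ→ℚ 2 + (- ℕ→ℚ 2 * δ p 0 + (- 1ℚ * δ p 1 + - 1ℚ * δ p (N ∸ 1)))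
  vvec-spikes zero          = refl
  vvec-spikes (suc zero)    = refl
  vvec-spikes (suc (suc p)) with suc (suc p) ≡ᵇ N ∸ 1
  ... | true  = refl
  ... | false = refl

  sum-spike : ∀ x w → w < N → sumℕ N (λ a → x * δ a w) ≡ x
  sum-spike x w w<N = trans (sumℕ-*ˡ N x (λ a → δ a w)) (trans (cong (x *_) (sumℕ-δ-one N w w<N)) (ℚP.*-identityʳ x))

  Dtilde-column-sum : ∀ b → b < N → sumℕ N (λ a → Dtilde n a b) ≡ ℕ→ℚ 2 * ℕ→ℚ N + - ℕ→ℚ 4
  Dtilde-column-sum b b<N = begin
    sumℕ N (λ a → Dtilde n a b)
      ≡⟨ sumℕ-cong N (λ a a<N → trans (vvec-spikes (offset a b))
           (cong₂ (λ u v → ℕ→ℚ 2 + (- ℕ→ℚ 2 * u + v)) (δ-offset⁻ a<N b<N (s≤s z≤n))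
             (cong₂ (λ u v → - 1ℚ * u + - 1ℚ * v) (δ-offset⁻ a<N b<N 1<N) (δ-offset⁻ a<N b<N ≤-refl)))) ⟩
    sumℕ N (λ a → ℕ→ℚ 2 + (f₀ a + (f₁ a + f₂ a)))
      ≡⟨ sumℕ-+ N (λ _ → ℕ→ℚ 2) (λ a → f₀ a + (f₁ a + f₂ a)) ⟩
    sumℕ N (λ _ → ℕ→ℚ 2) + sumℕ N (λ a → f₀ a + (f₁ a + f₂ a))
      ≡⟨ cong (sumℕ N (λ _ → ℕ→ℚ 2) +_) (trans (sumℕ-+ N f₀ (λ a → f₁ a + f₂ a)) (cong (sumℕ N f₀ +_) (sumℕ-+ N f₁ f₂))) ⟩
    sumℕ N (λ _ → ℕ→ℚ 2) + (sumℕ N f₀ + (sumℕ N f₁ + sumℕ N f₂))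
      ≡⟨ cong₂ _+_ (sumℕ-const N (ℕ→ℚ 2)) (cong₂ _+_ (sum-spike (- ℕ→ℚ 2) w₀ (m%n<n (b ℕ.+ (N ∸ 0)) N))
           (cong₂ _+_ (sum-spike (- 1ℚ) w₁ (m%n<n (b ℕ.+ (N ∸ 1)) N)) (sum-spike (- 1ℚ) w₂ (m%n<n (b ℕ.+ (N ∸ (N ∸ 1))) N)))) ⟩
    ℕ→ℚ N * ℕ→ℚ 2 + (- ℕ→ℚ 2 + (- 1ℚ + - 1ℚ))
      ≡⟨ solve 1 (λ x → x :* con (ℕ→ℚ 2) :+ (:- con (ℕ→ℚ 2) :+ (:- con 1ℚ :+ :- con 1ℚ)) := con (ℕ→ℚ 2) :* x :+ :- con (ℕ→ℚ 4)) refl (ℕ→ℚ N) ⟩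
    ℕ→ℚ 2 * ℕ→ℚ N + - ℕ→ℚ 4 ∎
    where
      open ≡-Reasoning
      open +-*-Solver
      w₀ w₁ w₂ : ℕ
      w₀ = (b ℕ.+ (N ∸ 0)) % N
      w₁ = (b ℕ.+ (N ∸ 1)) % N
      w₂ = (b ℕ.+ (N ∸ (N ∸ 1))) % N
      f₀ f₁ f₂ : ℕ → ℚ
      f₀ a = - ℕ→ℚ 2 * δ a w₀
      f₁ a = - 1ℚ * δ a w₁
      f₂ a = - 1ℚ * δ a w₂

  column-rim-rim : ∀ a b → column (rimv b) (rimv a) ≡ Dtilde n a b
  column-rim-rim a b = ℕ→ℚ-cycleDist (offset a b)

  column-rim-leaf : ∀ a b → column (rimv b) (leaf a) ≡ 1ℚ + Dtilde n a b
  column-rim-leaf a b = trans (ℕ→ℚ-suc (rimDist a b)) (cong (1ℚ +_) (ℕ→ℚ-cycleDist (offset a b)))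

  column-leaf-rim : ∀ a b → column (leaf b) (rimv a) ≡ 1ℚ + Dtilde n a b
  column-leaf-rim a b = trans (ℕ→ℚ-suc (rimDist a b)) (cong (1ℚ +_) (ℕ→ℚ-cycleDist (offset a b)))

  column-leaf-leaf : ∀ a b → column (leaf b) (leaf a) ≡ ℕ→ℚ 2 + Dtilde n a b + - (ℕ→ℚ 2 * δ a b)
  column-leaf-leaf a b = by-cases (a ≡ᵇ b) (≡ᵇ-reflects a b)
    where
      open +-*-Solver
      by-cases : ∀ e → Reflects (a ≡ b) e →
                 ℕ→ℚ (if e then 0 else suc (suc (rimDist a b))) ≡ ℕ→ℚ 2 + Dtilde n a b + - (ℕ→ℚ 2 * (if e then 1ℚ else 0ℚ))
      by-cases true  (ofʸ refl) = sym (cong (λ p → ℕ→ℚ 2 + vvec n p + - (ℕ→ℚ 2 * 1ℚ)) (offset-self a))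
      by-cases false _ = begin
        ℕ→ℚ (suc (suc (rimDist a b)))   ≡⟨ trans (ℕ→ℚ-suc (suc (rimDist a b))) (cong (1ℚ +_) (ℕ→ℚ-suc (rimDist a b))) ⟩
        1ℚ + (1ℚ + ℕ→ℚ (rimDist a b))   ≡⟨ cong (λ w → 1ℚ + (1ℚ + w)) (ℕ→ℚ-cycleDist (offset a b)) ⟩
        1ℚ + (1ℚ + Dtilde n a b)         ≡⟨ solve 1 (λ x → con 1ℚ :+ (con 1ℚ :+ x) := con (ℕ→ℚ 2) :+ x :+ :- (con (ℕ→ℚ 2) :* con 0ℚ)) refl (Dtilde n a b) ⟩
        ℕ→ℚ 2 + Dtilde n a b + - (ℕ→ℚ 2 * 0ℚ) ∎
        where open ≡-Reasoning

  circulantPart-cong : ∀ a' {f g : ℕ → ℚ} → (∀ a → f a ≡ g a) → circulantPart a' f ≡ circulantPart a' g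
  circulantPart-cong a' f≗g = sumℕ-cong (hm1 n) (λ k _ → cong (coef n (suc k) *_) (cong₂ _+_ (f≗g _) (f≗g _)))

  ℕ→ℚ-N : ℕ→ℚ N ≡ 1ℚ + (ℕ→ℚ t + ℕ→ℚ t)
  ℕ→ℚ-N = trans (ℕ→ℚ-suc (t ℕ.* 2)) (cong (1ℚ +_) (ℕ→ℚ-double t))

  half-5-n : half (ℤ.+ 5 ℤ.- ℤ.+ n) ≡ ½ * (ℕ→ℚ 5 + - (1ℚ + ℕ→ℚ N))
  half-5-n = trans (half-ℕ-difference 5 n) (cong (λ w → ½ * (ℕ→ℚ 5 + - w)) (ℕ→ℚ-suc N))

  ℒD-centre-centre : vertexSum (λ Z → lap centre Z * column centre Z) ≡ half (ℤ.+ 1 ℤ.- ℤ.+ n)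
  ℒD-centre-centre = begin
    vertexSum (λ Z → lap centre Z * column centre Z)
      ≡⟨ row-centre (column centre) ⟩
    ½ * x * ℕ→ℚ 0 + - ½ * sumℕ N (λ _ → ℕ→ℚ 1)
      ≡⟨ cong (λ w → ½ * x * ℕ→ℚ 0 + - ½ * w) (sumℕ-const N (ℕ→ℚ 1)) ⟩
    ½ * x * ℕ→ℚ 0 + - ½ * (x * ℕ→ℚ 1)
      ≡⟨ solve 1 (λ x → con ½ :* x :* con 0ℚ :+ con (- ½) :* (x :* con 1ℚ) := con ½ :* (con 1ℚ :+ :- (con 1ℚ :+ x))) refl x ⟩
    ½ * (ℕ→ℚ 1 + - (1ℚ + x))
      ≡⟨ cong (λ w → ½ * (ℕ→ℚ 1 + - w)) (ℕ→ℚ-suc N) ⟨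
    ½ * (ℕ→ℚ 1 + - ℕ→ℚ n)
      ≡⟨ half-ℕ-difference 1 n ⟨
    half (ℤ.+ 1 ℤ.- ℤ.+ n) ∎
    where
      open ≡-Reasoning
      open +-*-Solver
      x = ℕ→ℚ N

  ℒD-centre-rim : ∀ b → b < N → vertexSum (λ Z → lap centre Z * column (rimv b) Z) ≡ half (ℤ.+ 5 ℤ.- ℤ.+ n)
  ℒD-centre-rim b b<N = begin
    vertexSum (λ Z → lap centre Z * column (rimv b) Z)
      ≡⟨ row-centre (column (rimv b)) ⟩
    ½ * x * ℕ→ℚ 1 + - ½ * sumℕ N (λ a → column (rimv b) (rimv a))
      ≡⟨ cong (λ w → ½ * x * ℕ→ℚ 1 + - ½ * w) (trans (sumℕ-cong N (λ a _ → column-rim-rim a b)) (Dtilde-column-sum b b<N)) ⟩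
    ½ * x * ℕ→ℚ 1 + - ½ * (ℕ→ℚ 2 * x + - ℕ→ℚ 4)
      ≡⟨ solve 1 (λ x → con ½ :* x :* con 1ℚ :+ con (- ½) :* (con (ℕ→ℚ 2) :* x :+ :- con (ℕ→ℚ 4))
                      := con ½ :* (con (ℕ→ℚ 5) :+ :- (con 1ℚ :+ x))) refl x ⟩
    ½ * (ℕ→ℚ 5 + - (1ℚ + x))
      ≡⟨ half-5-n ⟨
    half (ℤ.+ 5 ℤ.- ℤ.+ n) ∎
    where
      open ≡-Reasoning
      open +-*-Solver
      x = ℕ→ℚ N

  ℒD-centre-leaf : ∀ b → b < N → vertexSum (λ Z → lap centre Z * column (leaf b) Z) ≡ half (ℤ.+ 5 ℤ.- ℤ.+ n)
  ℒD-centre-leaf b b<N = begin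
    vertexSum (λ Z → lap centre Z * column (leaf b) Z)
      ≡⟨ row-centre (column (leaf b)) ⟩
    ½ * x * ℕ→ℚ 2 + - ½ * sumℕ N (λ a → column (leaf b) (rimv a))
      ≡⟨ cong (λ w → ½ * x * ℕ→ℚ 2 + - ½ * w) rimSum ⟩
    ½ * x * ℕ→ℚ 2 + - ½ * (x * 1ℚ + (ℕ→ℚ 2 * x + - ℕ→ℚ 4))
      ≡⟨ solve 1 (λ x → con ½ :* x :* con (ℕ→ℚ 2) :+ con (- ½) :* (x :* con 1ℚ :+ (con (ℕ→ℚ 2) :* x :+ :- con (ℕ→ℚ 4)))
                      := con ½ :* (con (ℕ→ℚ 5) :+ :- (con 1ℚ :+ x))) refl x ⟩
    ½ * (ℕ→ℚ 5 + - (1ℚ + x))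
      ≡⟨ half-5-n ⟨
    half (ℤ.+ 5 ℤ.- ℤ.+ n) ∎
    where
      open ≡-Reasoning
      open +-*-Solver
      x = ℕ→ℚ N
      rimSum : sumℕ N (λ a → column (leaf b) (rimv a)) ≡ x * 1ℚ + (ℕ→ℚ 2 * x + - ℕ→ℚ 4)
      rimSum = begin
        sumℕ N (λ a → column (leaf b) (rimv a))          ≡⟨ sumℕ-cong N (λ a _ → column-leaf-rim a b) ⟩
        sumℕ N (λ a → 1ℚ + Dtilde n a b)                 ≡⟨ sumℕ-+ N (λ _ → 1ℚ) (λ a → Dtilde n a b) ⟩
        sumℕ N (λ _ → 1ℚ) + sumℕ N (λ a → Dtilde n a b)  ≡⟨ cong₂ _+_ (sumℕ-const N 1ℚ) (Dtilde-column-sum b b<N) ⟩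
        x * 1ℚ + (ℕ→ℚ 2 * x + - ℕ→ℚ 4)                    ∎

  ℒD-leaf-row : ∀ a' Y → a' < N → vertexSum (λ Z → lap (leaf a') Z * column Y Z) ≡ RHSblocks n (fsuc (fsuc fzero)) (kind Y) a' (pos Y)
  ℒD-leaf-row a' Y a'<N = trans (row-leaf a' (column Y) a'<N) (by-column Y)
    where
      open +-*-Solver
      by-column : ∀ Y → - 1ℚ * column Y (rimv a') + column Y (leaf a') ≡ RHSblocks n (fsuc (fsuc fzero)) (kind Y) a' (pos Y)
      by-column centre   = refl
      by-column (rimv b) = trans (cong₂ (λ u v → - 1ℚ * u + v) (column-rim-rim a' b) (column-rim-leaf a' b))
        (solve 1 (λ d → :- con 1ℚ :* d :+ (con 1ℚ :+ d) := con 1ℚ) refl (Dtilde n a' b))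
      by-column (leaf b) = trans (cong₂ (λ u v → - 1ℚ * u + v) (column-leaf-rim a' b) (column-leaf-leaf a' b))
        (solve 2 (λ d e → :- con 1ℚ :* (con 1ℚ :+ d) :+ (con (ℕ→ℚ 2) :+ d :+ :- (con (ℕ→ℚ 2) :* e))
                       := con 1ℚ :+ :- (con (ℕ→ℚ 2) :* e)) refl (Dtilde n a' b) (δ a' b))

  ℕ→ℚ-n+1 : ℕ→ℚ (suc n) ≡ 1ℚ + (1ℚ + ℕ→ℚ N)
  ℕ→ℚ-n+1 = trans (ℕ→ℚ-suc n) (cong (1ℚ +_) (ℕ→ℚ-suc N))

  ℕ→ℚ-n+1-via-t : ℕ→ℚ (suc n) ≡ 1ℚ + (1ℚ + (1ℚ + (ℕ→ℚ t + ℕ→ℚ t)))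
  ℕ→ℚ-n+1-via-t = trans ℕ→ℚ-n+1 (cong (λ w → 1ℚ + (1ℚ + w)) ℕ→ℚ-N)

  Bmat-entry : ∀ a' b → Bmat n a' b ≡ ½ * ℕ→ℚ N * Dtilde n a' b + - half (ℤ.+ 3) + circulantSum (offset a' b)
  Bmat-entry a' b = cong (λ w → w * Dtilde n a' b + - half (ℤ.+ 3) + circulantSum (offset a' b)) (half≡½* (ℤ.+ N))

  ℒD-rim-centre : ∀ a' → a' < N → vertexSum (λ Z → lap (rimv a') Z * column centre Z) ≡ - ½
  ℒD-rim-centre a' a'<N = begin
    vertexSum (λ Z → lap (rimv a') Z * column centre Z)
      ≡⟨ row-rim a' (column centre) a'<N ⟩
    - ½ * ℕ→ℚ 0 + ½ * ℕ→ℚ (suc n) * ℕ→ℚ 1 + circulantPart a' (λ _ → ℕ→ℚ 1) + - 1ℚ * ℕ→ℚ 2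
      ≡⟨ cong₂ (λ u v → - ½ * ℕ→ℚ 0 + ½ * u * ℕ→ℚ 1 + v + - 1ℚ * ℕ→ℚ 2) ℕ→ℚ-n+1-via-t (circulantPart-const a' (ℕ→ℚ 1)) ⟩
    - ½ * ℕ→ℚ 0 + ½ * (1ℚ + (1ℚ + (1ℚ + (τ + τ)))) * ℕ→ℚ 1 + - (τ * ℕ→ℚ 1) + - 1ℚ * ℕ→ℚ 2
      ≡⟨ solve 1 (λ τ → con (- ½) :* con 0ℚ :+ con ½ :* (con 1ℚ :+ (con 1ℚ :+ (con 1ℚ :+ (τ :+ τ)))) :* con 1ℚ
                      :+ :- (τ :* con 1ℚ) :+ :- con 1ℚ :* con (ℕ→ℚ 2) := con (- ½)) refl τ ⟩
    - ½ ∎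
    where
      open ≡-Reasoning
      open +-*-Solver
      τ = ℕ→ℚ t

  ℒD-rim-rim : ∀ a' b → a' < N → b < N → vertexSum (λ Z → lap (rimv a') Z * column (rimv b) Z) ≡ Bmat n a' b
  ℒD-rim-rim a' b a'<N b<N = begin
    vertexSum (λ Z → lap (rimv a') Z * column (rimv b) Z)
      ≡⟨ row-rim a' (column (rimv b)) a'<N ⟩
    - ½ * ℕ→ℚ 1 + ½ * ℕ→ℚ (suc n) * column (rimv b) (rimv a') + circulantPart a' (λ a → column (rimv b) (rimv a))
      + - 1ℚ * column (rimv b) (leaf a')
      ≡⟨ cong₂ (λ u v → - ½ * ℕ→ℚ 1 + ½ * ℕ→ℚ (suc n) * u + v + - 1ℚ * column (rimv b) (leaf a')) (column-rim-rim a' b)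
           (trans (circulantPart-cong a' (λ a → column-rim-rim a b)) (circulantPart-Dtilde a' b a'<N b<N)) ⟩
    - ½ * ℕ→ℚ 1 + ½ * ℕ→ℚ (suc n) * D + K + - 1ℚ * column (rimv b) (leaf a')
      ≡⟨ cong₂ (λ u v → - ½ * ℕ→ℚ 1 + ½ * u * D + K + - 1ℚ * v) ℕ→ℚ-n+1 (column-rim-leaf a' b) ⟩
    - ½ * ℕ→ℚ 1 + ½ * (1ℚ + (1ℚ + ℕ→ℚ N)) * D + K + - 1ℚ * (1ℚ + D)
      ≡⟨ solve 3 (λ x D K → con (- ½) :* con 1ℚ :+ con ½ :* (con 1ℚ :+ (con 1ℚ :+ x)) :* D :+ K :+ :- con 1ℚ :* (con 1ℚ :+ D)
                        := con ½ :* x :* D :+ :- con (half (ℤ.+ 3)) :+ K) refl (ℕ→ℚ N) D K ⟩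
    ½ * ℕ→ℚ N * D + - half (ℤ.+ 3) + K
      ≡⟨ Bmat-entry a' b ⟨
    Bmat n a' b ∎
    where
      open ≡-Reasoning
      open +-*-Solver
      D = Dtilde n a' b
      K = circulantSum (offset a' b)

  ℒD-rim-leaf : ∀ a' b → a' < N → b < N → vertexSum (λ Z → lap (rimv a') Z * column (leaf b) Z) ≡ ℕ→ℚ 2 * δ a' b + Bmat n a' b
  ℒD-rim-leaf a' b a'<N b<N = begin
    vertexSum (λ Z → lap (rimv a') Z * column (leaf b) Z)
      ≡⟨ row-rim a' (column (leaf b)) a'<N ⟩
    - ½ * ℕ→ℚ 2 + ½ * ℕ→ℚ (suc n) * column (leaf b) (rimv a') + circulantPart a' (λ a → column (leaf b) (rimv a))
      + - 1ℚ * column (leaf b) (leaf a')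
      ≡⟨ cong₂ (λ u v → - ½ * ℕ→ℚ 2 + ½ * ℕ→ℚ (suc n) * u + v + - 1ℚ * column (leaf b) (leaf a')) (column-leaf-rim a' b) circ ⟩
    - ½ * ℕ→ℚ 2 + ½ * ℕ→ℚ (suc n) * (1ℚ + D) + (- (τ * 1ℚ) + K) + - 1ℚ * column (leaf b) (leaf a')
      ≡⟨ cong₂ (λ u v → - ½ * ℕ→ℚ 2 + ½ * u * (1ℚ + D) + (- (τ * 1ℚ) + K) + - 1ℚ * v) ℕ→ℚ-n+1-via-t (column-leaf-leaf a' b) ⟩
    - ½ * ℕ→ℚ 2 + ½ * (1ℚ + (1ℚ + (1ℚ + (τ + τ)))) * (1ℚ + D) + (- (τ * 1ℚ) + K) + - 1ℚ * (ℕ→ℚ 2 + D + - (ℕ→ℚ 2 * e))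
      ≡⟨ solve 4 (λ τ D K e → con (- ½) :* con (ℕ→ℚ 2) :+ con ½ :* (con 1ℚ :+ (con 1ℚ :+ (con 1ℚ :+ (τ :+ τ)))) :* (con 1ℚ :+ D)
                               :+ (:- (τ :* con 1ℚ) :+ K) :+ :- con 1ℚ :* (con (ℕ→ℚ 2) :+ D :+ :- (con (ℕ→ℚ 2) :* e))
                             := con (ℕ→ℚ 2) :* e :+ (con ½ :* (con 1ℚ :+ (τ :+ τ)) :* D :+ :- con (half (ℤ.+ 3)) :+ K))
           refl τ D K e ⟩
    ℕ→ℚ 2 * e + (½ * (1ℚ + (τ + τ)) * D + - half (ℤ.+ 3) + K)
      ≡⟨ cong (λ w → ℕ→ℚ 2 * e + (½ * w * D + - half (ℤ.+ 3) + K)) ℕ→ℚ-N ⟨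
    ℕ→ℚ 2 * e + (½ * ℕ→ℚ N * D + - half (ℤ.+ 3) + K)
      ≡⟨ cong (ℕ→ℚ 2 * e +_) (Bmat-entry a' b) ⟨
    ℕ→ℚ 2 * e + Bmat n a' b ∎
    where
      open ≡-Reasoning
      open +-*-Solver
      τ = ℕ→ℚ t
      D = Dtilde n a' b
      K = circulantSum (offset a' b)
      e = δ a' b
      circ : circulantPart a' (λ a → column (leaf b) (rimv a)) ≡ - (τ * 1ℚ) + K
      circ = begin
        circulantPart a' (λ a → column (leaf b) (rimv a))                   ≡⟨ circulantPart-cong a' (λ a → column-leaf-rim a b) ⟩
        circulantPart a' (λ a → 1ℚ + Dtilde n a b)                          ≡⟨ circulantPart-+ a' (λ _ → 1ℚ) (λ a → Dtilde n a b) ⟩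
        circulantPart a' (λ _ → 1ℚ) + circulantPart a' (λ a → Dtilde n a b) ≡⟨ cong₂ _+_ (circulantPart-const a' 1ℚ)
                                                                                         (circulantPart-Dtilde a' b a'<N b<N) ⟩
        - (τ * 1ℚ) + K                                                      ∎

  ℒD-vertex : ∀ X Y → InRange X → InRange Y →
              vertexSum (λ Z → lap X Z * column Y Z) ≡ RHSblocks n (kind X) (kind Y) (pos X) (pos Y)
  ℒD-vertex centre   centre   _   _   = ℒD-centre-centre
  ℒD-vertex centre   (rimv b) _   b<N = ℒD-centre-rim b b<N
  ℒD-vertex centre   (leaf b) _   b<N = ℒD-centre-leaf b b<N
  ℒD-vertex (rimv a) centre   a<N _   = ℒD-rim-centre a a<N
  ℒD-vertex (rimv a) (rimv b) a<N b<N = ℒD-rim-rim a b a<N b<N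
  ℒD-vertex (rimv a) (leaf b) a<N b<N = ℒD-rim-leaf a b a<N b<N
  ℒD-vertex (leaf a) Y        a<N _   = ℒD-leaf-row a Y a<N

  ℒD≡RHS-at : ∀ i j X Y → InRange X → InRange Y → toℕ i ≡ index X → toℕ j ≡ index Y →
              mul (LapHelm n) (DistHelm n) i j ≡ RHS n i j
  ℒD≡RHS-at i j X Y x y i≡X j≡Y = begin
    mul (LapHelm n) (DistHelm n) i j               ≡⟨ ℒD-entry X Y x y i j i≡X j≡Y ⟩
    vertexSum (λ Z → lap X Z * column Y Z)         ≡⟨ ℒD-vertex X Y x y ⟩
    RHSblocks n (kind X) (kind Y) (pos X) (pos Y)  ≡⟨ onBlocks-index (RHSblocks n) X Y x y ⟨
    onBlocks (RHSblocks n) (index X) (index Y)     ≡⟨ cong₂ (onBlocks (RHSblocks n)) i≡X j≡Y ⟨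
    onBlocks (RHSblocks n) (toℕ i) (toℕ j)         ∎
    where open ≡-Reasoning

  -- Taking any k ≡ n lets callers with a different normal form of n avoid unfolding the matrices.
  ℒD≡RHS : ∀ {k} → k ≡ n → ∀ i j → mul (LapHelm k) (DistHelm k) i j ≡ RHS k i j
  ℒD≡RHS refl i j = at (index-surjective (toℕ i) (toℕ<n i)) (index-surjective (toℕ j) (toℕ<n j))
    where
      at : (Σ Vertex λ X → InRange X × toℕ i ≡ index X) → (Σ Vertex λ Y → InRange Y × toℕ j ≡ index Y) →
           mul (LapHelm n) (DistHelm n) i j ≡ RHS n i j
      at (X , x , i≡X) (Y , y , j≡Y) = ℒD≡RHS-at i j X Y x y i≡X j≡Y

-- The identity holds for every even n ≥ 4; the hypothesis 8 ≤ n is only needed to exclude n = 0, 2.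
mainTheorem10 : (n : ℕ) → 8 ≤ n → 2 ∣ n →
    ∀ i j → mul (LapHelm n) (DistHelm n) i j ≡ RHS n i j
mainTheorem10 _ _              (divides (suc (suc r)) refl) = HelmProduct.ℒD≡RHS r refl
mainTheorem10 _ ()             (divides 0 refl)
mainTheorem10 _ (s≤s (s≤s ())) (divides 1 refl)
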